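{- Let $\ell$ be an odd integer greater than one, $p$ a prime divisor of $\ell$, and $a$ the largest positive integer such that $p^a$ divides $\ell$. Then for every positive integer $k$, the following congruence of $q$-series (coefficientwise, modulo $p^k$) holds: $$\frac{\eta(24z)^{p^{a+k}-1}\,\eta(48z)\,\eta(24\ell z)\,\eta(96\ell z)}{\eta(96z)\,\eta(48\ell z)\,\eta(24p^{a}z)^{p^{k}}}\equiv \sum_{n=0}^{\infty}pod_\ell(n)\,q^{24n+3(\ell-1)}\pmod{p^k}.$$
   Context: Here $q=e^{2\pi i z}$ with $z$ in the upper half plane, and $\eta(z)=q^{1/24}\prod_{n\ge1}(1-q^n)$ is Dedekind's eta function; the left side is a power series in $q$ with integer coefficients. For a positive integer $\ell$, $pod_\ell(n)$ denotes the number of partitions of $n$ in which no part is divisible by $\ell$, the odd parts are distinct, and the even parts are unrestricted; equivalently $\sum_{n\ge0}pod_\ell(n)q^n=\psi(-q^\ell)/\psi(-q)$ with $\psi(q)=\sum_{n\ge0}q^{n(n+1)/2}$. -}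

module Defs where

open import Data.Nat as ℕ using (ℕ; zero; suc; _≤ᵇ_; _≡ᵇ_; _%_; _/_; _^_)
open import Data.Nat.Divisibility using (_∣?_)
open import Data.Integer as ℤ using (ℤ; +_; -[1+_])
open import Data.List using (List; []; _∷_; foldr; map; upTo)
open import Data.Nat.ListAction using (sum)
open import Data.Bool using (Bool; true; false; if_then_else_)
open import Data.Product using (_×_; _,_)
open import Relation.Nullary using (does)

PS : Set
PS = ℕ → ℤ

one : PS
one zero    = + 1
one (suc _) = + 0

sumTo : ℕ → (ℕ → ℤ) → ℤ
sumTo zero    f = f 0
sumTo (suc n) f = sumTo n f ℤ.+ f (suc n)

mul : PS → PS → PS
mul f g n = sumTo n (λ i → f i ℤ.* g (n ℕ.∸ i))

pow : PS → ℕ → PS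
pow f zero    = one
pow f (suc r) = mul f (pow f r)

prodPS : List PS → PS
prodPS = foldr mul one

-- 1 - q^(suc j)
oneMinusQ : ℕ → PS
oneMinusQ j n = if n ≡ᵇ 0 then + 1 else (if n ≡ᵇ suc j then ℤ.- (+ 1) else + 0)

-- 1 / (1 - q^(suc j)) = sum_{i ≥ 0} q^{(suc j) i}
geomQ : ℕ → PS
geomQ j n = if n % suc j ≡ᵇ 0 then + 1 else + 0

-- f(q) = prod_{m ≥ 1} (1 - q^m); the coefficient of q^n only depends on factors m ≤ n.
euler : PS
euler n = prodPS (map oneMinusQ (upTo n)) n

eulerInv : PS
eulerInv n = prodPS (map geomQ (upTo n)) n

-- dilate d F (q) = F(q^d), for d ≥ 1 (d = 0 is junk and never used).
dilate : ℕ → PS → PS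
dilate zero    f   = f
dilate (suc d) f n = if n % suc d ≡ᵇ 0 then f (n / suc d) else + 0

-- An eta quotient  prod_i η(d_i z)^{r_i}, given as the list of pairs (d_i , r_i).
EtaQuotient : Set
EtaQuotient = List (ℕ × ℤ)

-- η(dz)^r without its q^{dr/24} prefactor: f(q^d)^r.
etaFactor : ℕ × ℤ → PS
etaFactor (d , + r)     = pow (dilate d euler) r
etaFactor (d , -[1+ r ]) = pow (dilate d eulerInv) (suc r)

etaProd : EtaQuotient → PS
etaProd Q = prodPS (map etaFactor Q)

-- 24 × (order at infinity) = sum_i d_i r_i
order24 : EtaQuotient → ℤ
order24 = foldr (λ { (d , r) acc → (+ d) ℤ.* r ℤ.+ acc }) (+ 0)

-- Coefficient of q^e (e ∈ ℤ) of the eta quotient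
--   q^{order24/24} · etaProd Q
-- (zero when 24e - order24 is negative or not divisible by 24).
etaCoeff : EtaQuotient → ℤ → ℤ
etaCoeff Q e with (+ 24) ℤ.* e ℤ.- order24 Q
... | + m      = if m % 24 ≡ᵇ 0 then etaProd Q (m / 24) else + 0
... | -[1+ _ ] = + 0

-- podCount ℓ m n : number of partitions of n with all parts ≤ m, no part divisible
-- by ℓ, odd parts distinct, even parts unrestricted.
podCount : ℕ → ℕ → ℕ → ℕ
podCount ℓ zero    n = if n ≡ᵇ 0 then 1 else 0
podCount ℓ (suc m) n =
  if does (ℓ ∣? suc m) then podCount ℓ m n
  else (if suc m % 2 ≡ᵇ 1
        then podCount ℓ m n ℕ.+ (if suc m ≤ᵇ n then podCount ℓ m (n ℕ.∸ suc m) else 0)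
        -- even part suc m used j times, j = 0 .. n
        else sum (map (λ j → if j ℕ.* suc m ≤ᵇ n
                                          then podCount ℓ m (n ℕ.∸ j ℕ.* suc m) else 0)
                                (upTo (suc n))))

pod : ℕ → ℕ → ℕ
pod ℓ n = podCount ℓ n n

podSeriesCoeff : ℕ → ℤ → ℤ
podSeriesCoeff ℓ e with e ℤ.- (+ (3 ℕ.* (ℓ ℕ.∸ 1)))
... | + m      = if m % 24 ≡ᵇ 0 then + (pod ℓ (m / 24)) else + 0
... | -[1+ _ ] = + 0

theQuotient : ℕ → ℕ → ℕ → ℕ → EtaQuotient
theQuotient ℓ p a k =
  (24 , + (p ^ (a ℕ.+ k)) ℤ.- + 1) ∷
  (48 , + 1) ∷
  (24 ℕ.* ℓ , + 1) ∷
  (96 ℕ.* ℓ , + 1) ∷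
  (96 , ℤ.- + 1) ∷
  (48 ℕ.* ℓ , ℤ.- + 1) ∷
  (24 ℕ.* p ^ a , ℤ.- + (p ^ k)) ∷ []

-- Let f(q) = ∏_{m ≥ 1} (1 - q^m). With φ_m = 1 + q^m for odd m and φ_m = 1/(1 - q^m) for even m,
-- the generating function of pod_ℓ is ∏_{ℓ ∤ m} φ_m = Φ(q)/Φ(q^ℓ), where Φ = ∏_m φ_m and ℓ is odd;
-- moreover Φ(q) f(q) f(q^4) = f(q^2), since φ_m (1 - q^m) is 1 - q^(2m) or 1 as m is odd or even. So
--   ∑ pod_ℓ(n) q^n = f(q^2) f(q^ℓ) f(q^(4ℓ)) / (f(q) f(q^4) f(q^(2ℓ))),
-- and after q ↦ q^24 the stated quotient is this series times f(q^24)^(p^(a+k)) / f(q^(24 p^a))^(p^k).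
-- From (1 - q)^p ≡ 1 - q^p (mod p) we get f(q)^p ≡ f(q^p) (mod p), and raising a congruence
-- modulo p^j to the p-th power makes it hold modulo p^(j+1); hence f(q)^(p^(a+k)) ≡ f(q^(p^a))^(p^k)
-- (mod p^k) and the extra factor is ≡ 1 (mod p^k). Both sides start at q^(3(ℓ-1)).

module Submission where

open import Defs
open import Algebra.Bundles using (CommutativeRing)
open import Algebra.Structures using (IsCommutativeRing)
import Algebra.Solver.Ring.AlmostCommutativeRing as ACR
open import Data.Bool using (Bool; true; false; if_then_else_)
open import Data.Empty using (⊥-elim)
open import Data.Integer using (ℤ; +_; -[1+_]; _+_; _*_; _-_; -_)
import Data.Integer.Properties as ZP
import Data.Integer.Divisibility as ℤd
import Data.Integer.Divisibility.Signed as ZD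
open import Data.List using (map; upTo; applyUpTo)
import Data.List.Properties as LP
open import Data.Maybe using (Maybe; just; nothing)
open import Data.Nat as N using (ℕ; zero; suc; _≡ᵇ_; _≤ᵇ_; _<_; _≤_; z≤n; s≤s; _%_; _/_; _^_)
import Data.Nat.Properties as NP
import Data.Nat.DivMod as ND
open import Data.Nat.Combinatorics using (_C_; nCk+nC[k+1]≡[n+1]C[k+1]; k>n⇒nCk≡0; nCn≡1; nC1≡n)
open import Data.Nat.Divisibility as NDiv using (_∣_; _∣?_)
open import Data.Nat.ListAction using (sum)
open import Data.Nat.Primality using (Prime; euclidsLemma)
open import Data.Product using (_,_)
open import Data.Sum using (_⊎_; inj₁; inj₂)
open import Relation.Binary.Definitions using (tri<; tri≈; tri>)
open import Relation.Binary.PropositionalEquality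
open import Relation.Binary.Bundles using (Setoid)
import Relation.Binary.Reasoning.Setoid as SetoidReasoning
open import Relation.Nullary using (yes; no; ¬_; does)
open import Relation.Nullary.Decidable using (dec-true; dec-false)

-- Indicators and finite sums

when : Bool → ℤ → ℤ
when b x = if b then x else + 0

≡ᵇ-true : ∀ {m n} → m ≡ n → (m ≡ᵇ n) ≡ true
≡ᵇ-true {m} {n} = dec-true (m NP.≟ n)

≡ᵇ-false : ∀ {m n} → ¬ m ≡ n → (m ≡ᵇ n) ≡ false
≡ᵇ-false {m} {n} = dec-false (m NP.≟ n)

≤ᵇ-true : ∀ {m n} → m ≤ n → (m ≤ᵇ n) ≡ true
≤ᵇ-true {m} {n} = dec-true (m NP.≤? n)

≤ᵇ-false : ∀ {m n} → ¬ m ≤ n → (m ≤ᵇ n) ≡ false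
≤ᵇ-false {m} {n} = dec-false (m NP.≤? n)

≡ᵇ-cong-⇔ : ∀ {a b c d} → (a ≡ b → c ≡ d) → (c ≡ d → a ≡ b) → (a ≡ᵇ b) ≡ (c ≡ᵇ d)
≡ᵇ-cong-⇔ {a} {b} to from with a N.≟ b
... | yes a≡b = trans (≡ᵇ-true a≡b) (sym (≡ᵇ-true (to a≡b)))
... | no  a≢b = trans (≡ᵇ-false a≢b) (sym (≡ᵇ-false (λ c≡d → a≢b (from c≡d))))

≡ᵇ-sym : ∀ m n → (m ≡ᵇ n) ≡ (n ≡ᵇ m)
≡ᵇ-sym m n = ≡ᵇ-cong-⇔ {m} {n} sym sym

when-false : ∀ {b} x → b ≡ false → when b x ≡ + 0
when-false x refl = refl

when-0 : ∀ b → when b (+ 0) ≡ + 0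
when-0 true  = refl
when-0 false = refl

when-*ˡ : ∀ b x y → when b x * y ≡ when b (x * y)
when-*ˡ true  x y = refl
when-*ˡ false x y = ZP.*-zeroˡ y

when-*ʳ : ∀ b x y → x * when b y ≡ when b (x * y)
when-*ʳ true  x y = refl
when-*ʳ false x y = ZP.*-zeroʳ x

when-when : ∀ b c x → when b (when c x) ≡ when c (when b x)
when-when true  c     x = refl
when-when false true  x = refl
when-when false false x = refl

when-≤ᵇ-≡ᵇ : ∀ a m n x → a ≤ m → when (a ≤ᵇ n) (when (m ≡ᵇ n) x) ≡ when (m ≡ᵇ n) x
when-≤ᵇ-≡ᵇ a m n x a≤m with m N.≟ n
... | yes refl = cong (λ b → when b (when (m ≡ᵇ m) x)) (≤ᵇ-true a≤m)
... | no  m≢n  rewrite ≡ᵇ-false m≢n = when-0 (a ≤ᵇ n)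

when-as-* : ∀ b x y → when b (x * y) ≡ x * (y * when b (+ 1))
when-as-* true  x y = cong (x *_) (sym (ZP.*-identityʳ y))
when-as-* false x y = sym (trans (cong (x *_) (ZP.*-zeroʳ y)) (ZP.*-zeroʳ x))

when-when-as-* : ∀ a b x y → when a (when b (x * y)) ≡ x * (y * when a (when b (+ 1)))
when-when-as-* true  b x y = when-as-* b x y
when-when-as-* false b x y = sym (trans (cong (x *_) (ZP.*-zeroʳ y)) (ZP.*-zeroʳ x))

sumTo-cong : ∀ n {f g : ℕ → ℤ} → (∀ i → i ≤ n → f i ≡ g i) → sumTo n f ≡ sumTo n g
sumTo-cong zero    f≗g = f≗g 0 z≤n
sumTo-cong (suc n) f≗g =
  cong₂ _+_ (sumTo-cong n (λ i i≤n → f≗g i (NP.m≤n⇒m≤1+n i≤n))) (f≗g (suc n) NP.≤-refl)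

sumTo-cong′ : ∀ n {f g : ℕ → ℤ} → (∀ i → f i ≡ g i) → sumTo n f ≡ sumTo n g
sumTo-cong′ n f≗g = sumTo-cong n (λ i _ → f≗g i)

sumTo-0 : ∀ n → sumTo n (λ _ → + 0) ≡ + 0
sumTo-0 zero    = refl
sumTo-0 (suc n) rewrite sumTo-0 n = refl

sumTo-vanishing : ∀ n {f} → (∀ i → i ≤ n → f i ≡ + 0) → sumTo n f ≡ + 0
sumTo-vanishing n f≗0 = trans (sumTo-cong n f≗0) (sumTo-0 n)

sumTo-+ : ∀ n f g → sumTo n (λ i → f i + g i) ≡ sumTo n f + sumTo n g
sumTo-+ zero    f g = refl
sumTo-+ (suc n) f g rewrite sumTo-+ n f g = interchange (sumTo n f) (sumTo n g) (f (suc n)) (g (suc n))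
  where open import Algebra.Properties.CommutativeSemigroup ZP.+-commutativeSemigroup using (interchange)

sumTo-*ˡ : ∀ n c f → sumTo n (λ i → c * f i) ≡ c * sumTo n f
sumTo-*ˡ zero    c f = refl
sumTo-*ˡ (suc n) c f rewrite sumTo-*ˡ n c f = sym (ZP.*-distribˡ-+ c (sumTo n f) (f (suc n)))

sumTo-*ʳ : ∀ n c f → sumTo n (λ i → f i * c) ≡ sumTo n f * c
sumTo-*ʳ n c f =
  trans (sumTo-cong′ n (λ i → ZP.*-comm (f i) c)) (trans (sumTo-*ˡ n c f) (ZP.*-comm c (sumTo n f)))

sumTo-swap : ∀ n m (F : ℕ → ℕ → ℤ) →
             sumTo n (λ i → sumTo m (F i)) ≡ sumTo m (λ j → sumTo n (λ i → F i j))
sumTo-swap zero    m F = refl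
sumTo-swap (suc n) m F = begin
    sumTo n (λ i → sumTo m (F i)) + sumTo m (F (suc n))
  ≡⟨ cong (_+ sumTo m (F (suc n))) (sumTo-swap n m F) ⟩
    sumTo m (λ j → sumTo n (λ i → F i j)) + sumTo m (F (suc n))
  ≡⟨ sumTo-+ m _ _ ⟨
    sumTo m (λ j → sumTo n (λ i → F i j) + F (suc n) j) ∎
  where open ≡-Reasoning

sumTo-shift : ∀ n f → sumTo (suc n) f ≡ f 0 + sumTo n (λ i → f (suc i))
sumTo-shift zero    f = refl
sumTo-shift (suc n) f rewrite sumTo-shift n f = ZP.+-assoc (f 0) _ _

sumTo-split : ∀ m n f → sumTo (suc m N.+ n) f ≡ sumTo n f + sumTo m (λ i → f (suc (i N.+ n)))
sumTo-split zero    n f = refl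
sumTo-split (suc m) n f rewrite sumTo-split m n f = ZP.+-assoc (sumTo n f) _ _

sumTo-extend : ∀ n t f → (∀ i → n < i → i ≤ n N.+ t → f i ≡ + 0) → sumTo (n N.+ t) f ≡ sumTo n f
sumTo-extend n zero    f _ rewrite NP.+-identityʳ n = refl
sumTo-extend n (suc t) f tail≗0 rewrite NP.+-suc n t =
  trans (cong (_+_ (sumTo (n N.+ t) f)) (tail≗0 _ (s≤s (NP.m≤m+n n t)) NP.≤-refl))
        (trans (ZP.+-identityʳ _) (sumTo-extend n t f (λ i n<i i≤ → tail≗0 i n<i (NP.m≤n⇒m≤1+n i≤))))

sumTo-extend′ : ∀ n m f → n ≤ m → (∀ i → n < i → i ≤ m → f i ≡ + 0) → sumTo m f ≡ sumTo n f
sumTo-extend′ n m f n≤m tail≗0 with NP.m≤n⇒∃[o]m+o≡n n≤m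
... | t , refl = sumTo-extend n t f tail≗0

when-sumTo : ∀ b n F → when b (sumTo n F) ≡ sumTo n (λ i → when b (F i))
when-sumTo true  n F = refl
when-sumTo false n F = sym (sumTo-0 n)

when-sumTo²-*ʳ : ∀ b n (X : ℕ → ℕ → ℤ) y →
  when b (sumTo n (λ i → sumTo n (X i)) * y) ≡ sumTo n (λ i → sumTo n (λ j → when b (X i j * y)))
when-sumTo²-*ʳ b n X y = begin
    when b (sumTo n (λ i → sumTo n (X i)) * y)
  ≡⟨ cong (when b) (trans (sym (sumTo-*ʳ n y _)) (sumTo-cong′ n (λ i → sym (sumTo-*ʳ n y (X i))))) ⟩
    when b (sumTo n (λ i → sumTo n (λ j → X i j * y)))
  ≡⟨ trans (when-sumTo b n _) (sumTo-cong′ n (λ i → when-sumTo b n _)) ⟩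
    sumTo n (λ i → sumTo n (λ j → when b (X i j * y))) ∎
  where open ≡-Reasoning

when-sumTo²-*ˡ : ∀ b n (X : ℕ → ℕ → ℤ) y →
  when b (y * sumTo n (λ i → sumTo n (X i))) ≡ sumTo n (λ i → sumTo n (λ j → when b (y * X i j)))
when-sumTo²-*ˡ b n X y = begin
    when b (y * sumTo n (λ i → sumTo n (X i)))
  ≡⟨ cong (when b) (trans (sym (sumTo-*ˡ n y _)) (sumTo-cong′ n (λ i → sym (sumTo-*ˡ n y (X i))))) ⟩
    when b (sumTo n (λ i → sumTo n (λ j → y * X i j)))
  ≡⟨ trans (when-sumTo b n _) (sumTo-cong′ n (λ i → when-sumTo b n _)) ⟩
    sumTo n (λ i → sumTo n (λ j → when b (y * X i j))) ∎
  where open ≡-Reasoning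

sumTo-when-≡ᵇ : ∀ n c (h : ℕ → ℤ) → sumTo n (λ i → when (i ≡ᵇ c) (h i)) ≡ when (c ≤ᵇ n) (h c)
sumTo-when-≡ᵇ zero    zero    h = refl
sumTo-when-≡ᵇ zero    (suc c) h = refl
sumTo-when-≡ᵇ (suc n) c       h rewrite sumTo-when-≡ᵇ n c h with N.<-cmp c (suc n)
... | tri< c<1+n c≢1+n _
  rewrite ≤ᵇ-true (NP.≤-pred c<1+n) | ≡ᵇ-false {suc n} {c} (λ e → c≢1+n (sym e))
        | ≤ᵇ-true (NP.<⇒≤ c<1+n) = ZP.+-identityʳ (h c)
... | tri≈ _ refl _
  rewrite ≤ᵇ-false (NP.<-irrefl {n} refl) | ≡ᵇ-true {n} refl | ≤ᵇ-true (NP.≤-refl {suc n}) =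
  ZP.+-identityˡ (h (suc n))
... | tri> _ c≢1+n 1+n<c
  rewrite ≤ᵇ-false (λ c≤n → NP.<⇒≱ 1+n<c (NP.m≤n⇒m≤1+n c≤n)) | ≡ᵇ-false {suc n} {c} (λ e → c≢1+n (sym e))
        | ≤ᵇ-false (NP.<⇒≱ 1+n<c) = refl

sumTo-when-+≡ᵇ : ∀ n B i (F : ℕ → ℤ) → n ≤ B →
                 sumTo B (λ j → when (i N.+ j ≡ᵇ n) (F j)) ≡ when (i ≤ᵇ n) (F (n N.∸ i))
sumTo-when-+≡ᵇ n B i F n≤B with i NP.≤? n
... | yes i≤n = begin
    sumTo B (λ j → when (i N.+ j ≡ᵇ n) (F j))
  ≡⟨ sumTo-cong′ B (λ j → cong (λ b → when b (F j)) (+≡ᵇ⇔∸ j)) ⟩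
    sumTo B (λ j → when (j ≡ᵇ n N.∸ i) (F j))
  ≡⟨ sumTo-when-≡ᵇ B (n N.∸ i) F ⟩
    when (n N.∸ i ≤ᵇ B) (F (n N.∸ i))
  ≡⟨ cong (λ b → when b (F (n N.∸ i))) (≤ᵇ-true (NP.≤-trans (NP.m∸n≤m n i) n≤B)) ⟩
    F (n N.∸ i)
  ≡⟨ cong (λ b → when b (F (n N.∸ i))) (≤ᵇ-true i≤n) ⟨
    when (i ≤ᵇ n) (F (n N.∸ i)) ∎
  where
  open ≡-Reasoning
  +≡ᵇ⇔∸ : ∀ j → (i N.+ j ≡ᵇ n) ≡ (j ≡ᵇ n N.∸ i)
  +≡ᵇ⇔∸ j = ≡ᵇ-cong-⇔ (λ e → trans (sym (NP.m+n∸m≡n i j)) (cong (N._∸ i) e))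
                      (λ e → trans (cong (i N.+_) e) (NP.m+[n∸m]≡n i≤n))
... | no i≰n = trans (sumTo-vanishing B (λ j _ → when-false (F j) (≡ᵇ-false (λ e → i≰n (subst (i ≤_) e (NP.m≤m+n i j))))))
                     (sym (when-false _ (≤ᵇ-false i≰n)))

-- The ring of power series

-- Summing over the square [0, B]² with the indicator of i + j = n, instead of over the triangle,
-- lets the Cauchy product be reordered with sumTo-swap.
mul-as-double-sum : ∀ (f g : PS) n B → n ≤ B →
                    mul f g n ≡ sumTo B (λ i → sumTo B (λ j → when (i N.+ j ≡ᵇ n) (f i * g j)))
mul-as-double-sum f g n B n≤B = sym (begin
    sumTo B (λ i → sumTo B (λ j → when (i N.+ j ≡ᵇ n) (f i * g j)))
  ≡⟨ sumTo-cong′ B (λ i → sumTo-when-+≡ᵇ n B i (λ j → f i * g j) n≤B) ⟩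
    sumTo B (λ i → when (i ≤ᵇ n) (f i * g (n N.∸ i)))
  ≡⟨ sumTo-extend′ n B _ n≤B (λ i n<i _ → when-false _ (≤ᵇ-false (NP.<⇒≱ n<i))) ⟩
    sumTo n (λ i → when (i ≤ᵇ n) (f i * g (n N.∸ i)))
  ≡⟨ sumTo-cong n (λ i i≤n → cong (λ b → when b (f i * g (n N.∸ i))) (≤ᵇ-true i≤n)) ⟩
    mul f g n ∎)
  where open ≡-Reasoning

mul-comm : ∀ f g n → mul f g n ≡ mul g f n
mul-comm f g n = begin
    mul f g n
  ≡⟨ mul-as-double-sum f g n n NP.≤-refl ⟩
    sumTo n (λ i → sumTo n (λ j → when (i N.+ j ≡ᵇ n) (f i * g j)))
  ≡⟨ sumTo-swap n n _ ⟩
    sumTo n (λ j → sumTo n (λ i → when (i N.+ j ≡ᵇ n) (f i * g j)))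
  ≡⟨ sumTo-cong′ n (λ j → sumTo-cong′ n (λ i →
       cong₂ when (cong (_≡ᵇ n) (NP.+-comm i j)) (ZP.*-comm (f i) (g j)))) ⟩
    sumTo n (λ j → sumTo n (λ i → when (j N.+ i ≡ᵇ n) (g j * f i)))
  ≡⟨ mul-as-double-sum g f n n NP.≤-refl ⟨
    mul g f n ∎
  where open ≡-Reasoning

tripleSum : PS → PS → PS → ℕ → ℤ
tripleSum f g h n =
  sumTo n (λ i → sumTo n (λ j → sumTo n (λ t → when (i N.+ (j N.+ t) ≡ᵇ n) (f i * (g j * h t)))))

mul-mulˡ-as-triple-sum : ∀ f g h n → mul (mul f g) h n ≡ tripleSum f g h n
mul-mulˡ-as-triple-sum f g h n = begin
    mul (mul f g) h n
  ≡⟨ mul-as-double-sum (mul f g) h n n NP.≤-refl ⟩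
    ∑ (λ s → ∑ (λ t → when (s N.+ t ≡ᵇ n) (mul f g s * h t)))
  ≡⟨ sumTo-cong n (λ s s≤n → sumTo-cong′ n (λ t →
       trans (cong (λ z → when (s N.+ t ≡ᵇ n) (z * h t)) (mul-as-double-sum f g s n s≤n)) (when-sumTo²-*ʳ _ n _ (h t)))) ⟩
    ∑ (λ s → ∑ (λ t → ∑ (λ i → ∑ (λ j → G s t i j))))
  ≡⟨ reorder ⟩
    ∑ (λ i → ∑ (λ j → ∑ (λ t → ∑ (λ s → G s t i j))))
  ≡⟨ sumTo-cong′ n (λ i → sumTo-cong′ n (λ j → sumTo-cong′ n (λ t → collapse i j t))) ⟩
    tripleSum f g h n ∎
  where
  open ≡-Reasoning
  ∑ = sumTo n
  G : ℕ → ℕ → ℕ → ℕ → ℤ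
  G s t i j = when (s N.+ t ≡ᵇ n) (when (i N.+ j ≡ᵇ s) (f i * g j) * h t)
  reorder : ∑ (λ s → ∑ (λ t → ∑ (λ i → ∑ (λ j → G s t i j)))) ≡ ∑ (λ i → ∑ (λ j → ∑ (λ t → ∑ (λ s → G s t i j))))
  reorder = begin
      ∑ (λ s → ∑ (λ t → ∑ (λ i → ∑ (λ j → G s t i j))))
    ≡⟨ sumTo-cong′ n (λ s → trans (sumTo-swap n n _) (sumTo-cong′ n (λ i → sumTo-swap n n _))) ⟩
      ∑ (λ s → ∑ (λ i → ∑ (λ j → ∑ (λ t → G s t i j))))
    ≡⟨ trans (sumTo-swap n n _) (sumTo-cong′ n (λ i → sumTo-swap n n _)) ⟩
      ∑ (λ i → ∑ (λ j → ∑ (λ s → ∑ (λ t → G s t i j))))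
    ≡⟨ sumTo-cong′ n (λ i → sumTo-cong′ n (λ j → sumTo-swap n n _)) ⟩
      ∑ (λ i → ∑ (λ j → ∑ (λ t → ∑ (λ s → G s t i j)))) ∎
  collapse : ∀ i j t → ∑ (λ s → G s t i j) ≡ when (i N.+ (j N.+ t) ≡ᵇ n) (f i * (g j * h t))
  collapse i j t = begin
      ∑ (λ s → G s t i j)
    ≡⟨ sumTo-cong′ n (λ s → trans (cong (when (s N.+ t ≡ᵇ n)) (when-*ˡ (i N.+ j ≡ᵇ s) (f i * g j) (h t)))
                     (trans (when-when (s N.+ t ≡ᵇ n) (i N.+ j ≡ᵇ s) _)
                            (cong (λ b → when b (when (s N.+ t ≡ᵇ n) (f i * g j * h t))) (≡ᵇ-sym (i N.+ j) s)))) ⟩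
      ∑ (λ s → when (s ≡ᵇ i N.+ j) (when (s N.+ t ≡ᵇ n) (f i * g j * h t)))
    ≡⟨ sumTo-when-≡ᵇ n (i N.+ j) _ ⟩
      when (i N.+ j ≤ᵇ n) (when (i N.+ j N.+ t ≡ᵇ n) (f i * g j * h t))
    ≡⟨ when-≤ᵇ-≡ᵇ (i N.+ j) (i N.+ j N.+ t) n _ (NP.m≤m+n _ t) ⟩
      when (i N.+ j N.+ t ≡ᵇ n) (f i * g j * h t)
    ≡⟨ cong₂ when (cong (_≡ᵇ n) (NP.+-assoc i j t)) (ZP.*-assoc (f i) (g j) (h t)) ⟩
      when (i N.+ (j N.+ t) ≡ᵇ n) (f i * (g j * h t)) ∎

mul-mulʳ-as-triple-sum : ∀ f g h n → mul f (mul g h) n ≡ tripleSum f g h n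
mul-mulʳ-as-triple-sum f g h n = begin
    mul f (mul g h) n
  ≡⟨ mul-as-double-sum f (mul g h) n n NP.≤-refl ⟩
    ∑ (λ i → ∑ (λ u → when (i N.+ u ≡ᵇ n) (f i * mul g h u)))
  ≡⟨ sumTo-cong′ n (λ i → sumTo-cong n (λ u u≤n →
       trans (cong (λ z → when (i N.+ u ≡ᵇ n) (f i * z)) (mul-as-double-sum g h u n u≤n)) (when-sumTo²-*ˡ _ n _ (f i)))) ⟩
    ∑ (λ i → ∑ (λ u → ∑ (λ j → ∑ (λ t → G i u j t))))
  ≡⟨ sumTo-cong′ n (λ i → trans (sumTo-swap n n _) (sumTo-cong′ n (λ j → sumTo-swap n n _))) ⟩
    ∑ (λ i → ∑ (λ j → ∑ (λ t → ∑ (λ u → G i u j t))))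
  ≡⟨ sumTo-cong′ n (λ i → sumTo-cong′ n (λ j → sumTo-cong′ n (λ t → collapse i j t))) ⟩
    tripleSum f g h n ∎
  where
  open ≡-Reasoning
  ∑ = sumTo n
  G : ℕ → ℕ → ℕ → ℕ → ℤ
  G i u j t = when (i N.+ u ≡ᵇ n) (f i * when (j N.+ t ≡ᵇ u) (g j * h t))
  collapse : ∀ i j t → ∑ (λ u → G i u j t) ≡ when (i N.+ (j N.+ t) ≡ᵇ n) (f i * (g j * h t))
  collapse i j t = begin
      ∑ (λ u → G i u j t)
    ≡⟨ sumTo-cong′ n (λ u → trans (cong (when (i N.+ u ≡ᵇ n)) (when-*ʳ (j N.+ t ≡ᵇ u) (f i) (g j * h t)))
                     (trans (when-when (i N.+ u ≡ᵇ n) (j N.+ t ≡ᵇ u) _)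
                            (cong (λ b → when b (when (i N.+ u ≡ᵇ n) (f i * (g j * h t)))) (≡ᵇ-sym (j N.+ t) u)))) ⟩
      ∑ (λ u → when (u ≡ᵇ j N.+ t) (when (i N.+ u ≡ᵇ n) (f i * (g j * h t))))
    ≡⟨ sumTo-when-≡ᵇ n (j N.+ t) _ ⟩
      when (j N.+ t ≤ᵇ n) (when (i N.+ (j N.+ t) ≡ᵇ n) (f i * (g j * h t)))
    ≡⟨ when-≤ᵇ-≡ᵇ (j N.+ t) (i N.+ (j N.+ t)) n _ (NP.m≤n+m _ i) ⟩
      when (i N.+ (j N.+ t) ≡ᵇ n) (f i * (g j * h t)) ∎

mul-assoc : ∀ f g h n → mul (mul f g) h n ≡ mul f (mul g h) n
mul-assoc f g h n = trans (mul-mulˡ-as-triple-sum f g h n) (sym (mul-mulʳ-as-triple-sum f g h n))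

infix 4 _≈_
record _≈_ (f g : PS) : Set where
  constructor mk≈
  field at : ∀ n → f n ≡ g n
open _≈_

≈-refl : ∀ {f} → f ≈ f
≈-refl = mk≈ λ n → refl

≈-sym : ∀ {f g} → f ≈ g → g ≈ f
≈-sym f≈g = mk≈ λ n → sym (at f≈g n)

≈-trans : ∀ {f g h} → f ≈ g → g ≈ h → f ≈ h
≈-trans f≈g g≈h = mk≈ λ n → trans (at f≈g n) (at g≈h n)

≡⇒≈ : ∀ {f g} → f ≡ g → f ≈ g
≡⇒≈ refl = ≈-refl

addPS : PS → PS → PS
addPS f g n = f n + g n

negPS : PS → PS
negPS f n = - f n

zeroPS : PS
zeroPS n = + 0

mul-cong : ∀ {f f′ g g′} → f ≈ f′ → g ≈ g′ → mul f g ≈ mul f′ g′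
mul-cong f≈f′ g≈g′ = mk≈ λ n → sumTo-cong′ n (λ i → cong₂ _*_ (at f≈f′ i) (at g≈g′ (n N.∸ i)))

mul-identityʳ : ∀ f → mul f one ≈ f
mul-identityʳ f = mk≈ coeff
  where
  coeff : ∀ n → mul f one n ≡ f n
  coeff zero    = ZP.*-identityʳ (f 0)
  coeff (suc n) = begin
      sumTo n (λ i → f i * one (suc n N.∸ i)) + f (suc n) * one (n N.∸ n)
    ≡⟨ cong (λ k → sumTo n (λ i → f i * one (suc n N.∸ i)) + f (suc n) * one k) (NP.n∸n≡0 n) ⟩
      sumTo n (λ i → f i * one (suc n N.∸ i)) + f (suc n) * + 1
    ≡⟨ cong₂ _+_ (sumTo-vanishing n (λ i i≤n → trans (cong (λ k → f i * one k) (NP.+-∸-assoc 1 i≤n)) (ZP.*-zeroʳ (f i))))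
                 (ZP.*-identityʳ (f (suc n))) ⟩
      + 0 + f (suc n)
    ≡⟨ ZP.+-identityˡ _ ⟩
      f (suc n) ∎
    where open ≡-Reasoning

mul-identityˡ : ∀ f → mul one f ≈ f
mul-identityˡ f = mk≈ λ n → trans (mul-comm one f n) (at (mul-identityʳ f) n)

mul-distribˡ : ∀ f g h → mul f (addPS g h) ≈ addPS (mul f g) (mul f h)
mul-distribˡ f g h = mk≈ λ n → trans (sumTo-cong′ n (λ i → ZP.*-distribˡ-+ (f i) _ _)) (sumTo-+ n _ _)

mul-distribʳ : ∀ f g h → mul (addPS g h) f ≈ addPS (mul g f) (mul h f)
mul-distribʳ f g h = mk≈ λ n →
  trans (mul-comm (addPS g h) f n) (trans (at (mul-distribˡ f g h) n) (cong₂ _+_ (mul-comm f g n) (mul-comm f h n)))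

PS-isCommutativeRing : IsCommutativeRing _≈_ addPS mul negPS zeroPS one
PS-isCommutativeRing = record
  { isRing = record
    { +-isAbelianGroup = record
      { isGroup = record
        { isMonoid = record
          { isSemigroup = record
            { isMagma = record
              { isEquivalence = record { refl = ≈-refl ; sym = ≈-sym ; trans = ≈-trans }
              ; ∙-cong = λ f≈f′ g≈g′ → mk≈ λ n → cong₂ _+_ (at f≈f′ n) (at g≈g′ n) }
            ; assoc = λ f g h → mk≈ λ n → ZP.+-assoc (f n) (g n) (h n) }
          ; identity = (λ f → mk≈ λ n → ZP.+-identityˡ (f n)) , (λ f → mk≈ λ n → ZP.+-identityʳ (f n)) }
        ; inverse = (λ f → mk≈ λ n → ZP.+-inverseˡ (f n)) , (λ f → mk≈ λ n → ZP.+-inverseʳ (f n))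
        ; ⁻¹-cong = λ f≈g → mk≈ λ n → cong -_ (at f≈g n) }
      ; comm = λ f g → mk≈ λ n → ZP.+-comm (f n) (g n) }
    ; *-cong = mul-cong
    ; *-assoc = λ f g h → mk≈ (mul-assoc f g h)
    ; *-identity = mul-identityˡ , mul-identityʳ
    ; distrib = mul-distribˡ , mul-distribʳ }
  ; *-comm = λ f g → mk≈ (mul-comm f g) }

PS-commutativeRing : CommutativeRing _ _
PS-commutativeRing = record { isCommutativeRing = PS-isCommutativeRing }

module ≈-Reasoning = SetoidReasoning (CommutativeRing.setoid PS-commutativeRing)

constant : ℤ → PS
constant c zero    = c
constant c (suc n) = + 0

mul-constantʳ : ∀ f c n → mul f (constant c) n ≡ f n * c
mul-constantʳ f c zero    = refl
mul-constantʳ f c (suc n) = begin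
    sumTo n (λ i → f i * constant c (suc n N.∸ i)) + f (suc n) * constant c (n N.∸ n)
  ≡⟨ cong (λ k → sumTo n (λ i → f i * constant c (suc n N.∸ i)) + f (suc n) * constant c k) (NP.n∸n≡0 n) ⟩
    sumTo n (λ i → f i * constant c (suc n N.∸ i)) + f (suc n) * c
  ≡⟨ cong (_+ f (suc n) * c) (sumTo-vanishing n (λ i i≤n →
       trans (cong (λ k → f i * constant c k) (NP.+-∸-assoc 1 i≤n)) (ZP.*-zeroʳ (f i)))) ⟩
    + 0 + f (suc n) * c
  ≡⟨ ZP.+-identityˡ _ ⟩
    f (suc n) * c ∎
  where open ≡-Reasoning

mul-constantˡ : ∀ c f n → mul (constant c) f n ≡ c * f n
mul-constantˡ c f n = trans (mul-comm (constant c) f n) (trans (mul-constantʳ f c n) (ZP.*-comm (f n) c))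

constant-homomorphism : ACR._-Raw-AlmostCommutative⟶_ (CommutativeRing.rawRing ZP.+-*-commutativeRing)
                                                      (ACR.fromCommutativeRing PS-commutativeRing)
constant-homomorphism = record
  { ⟦_⟧    = constant
  ; +-homo = λ a b → mk≈ λ { zero → refl ; (suc n) → refl }
  ; *-homo = λ a b → mk≈ λ n → sym (trans (mul-constantˡ a (constant b) n) (scale-constant a b n))
  ; -‿homo = λ a → mk≈ λ { zero → refl ; (suc n) → refl }
  ; 0-homo = mk≈ λ { zero → refl ; (suc n) → refl }
  ; 1-homo = mk≈ λ { zero → refl ; (suc n) → refl } }
  where
  scale-constant : ∀ a b n → a * constant b n ≡ constant (a * b) n
  scale-constant a b zero    = refl
  scale-constant a b (suc n) = ZP.*-zeroʳ a

constant-≈? : ∀ a b → Maybe (constant a ≈ constant b)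
constant-≈? a b with a ZP.≟ b
... | yes refl = just ≈-refl
... | no  _    = nothing

open import Algebra.Solver.Ring (CommutativeRing.rawRing ZP.+-*-commutativeRing)
  (ACR.fromCommutativeRing PS-commutativeRing) constant-homomorphism constant-≈?
  using (solve; _:+_; _:*_; _:-_; _:=_)

pow-cong : ∀ {f g} r → f ≈ g → pow f r ≈ pow g r
pow-cong zero    f≈g = ≈-refl
pow-cong (suc r) f≈g = mul-cong f≈g (pow-cong r f≈g)

pow-+ : ∀ f a b → pow f (a N.+ b) ≈ mul (pow f a) (pow f b)
pow-+ f zero    b = ≈-sym (mul-identityˡ (pow f b))
pow-+ f (suc a) b = ≈-trans (mul-cong (≈-refl {f}) (pow-+ f a b)) (mk≈ (λ n → sym (mul-assoc f (pow f a) (pow f b) n)))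

pow-* : ∀ f a b → pow f (a N.* b) ≈ pow (pow f a) b
pow-* f a zero    rewrite NP.*-zeroʳ a = ≈-refl
pow-* f a (suc b) rewrite NP.*-suc a b = ≈-trans (pow-+ f a (a N.* b)) (mul-cong (≈-refl {pow f a}) (pow-* f a b))

pow-mul : ∀ f g r → pow (mul f g) r ≈ mul (pow f r) (pow g r)
pow-mul f g zero    = ≈-sym (mul-identityˡ one)
pow-mul f g (suc r) = ≈-trans (mul-cong (≈-refl {mul f g}) (pow-mul f g r))
  (solve 4 (λ f g a b → (f :* g) :* (a :* b) := (f :* a) :* (g :* b)) ≈-refl f g (pow f r) (pow g r))

pow-one : ∀ r → pow one r ≈ one
pow-one zero    = ≈-refl
pow-one (suc r) = ≈-trans (mul-identityˡ (pow one r)) (pow-one r)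

binomialQ : ℕ → ℤ → PS
binomialQ j c n = when (n ≡ᵇ 0) (+ 1) + when (n ≡ᵇ suc j) c

oneMinusQ≈binomialQ : ∀ j → oneMinusQ j ≈ binomialQ j (- + 1)
oneMinusQ≈binomialQ j = mk≈ λ { zero → refl ; (suc n) → sym (ZP.+-identityˡ _) }

mul-binomialQ : ∀ j c G n → mul (binomialQ j c) G n ≡ G n + when (suc j ≤ᵇ n) (c * G (n N.∸ suc j))
mul-binomialQ j c G n = begin
    sumTo n (λ i → (when (i ≡ᵇ 0) (+ 1) + when (i ≡ᵇ suc j) c) * G (n N.∸ i))
  ≡⟨ sumTo-cong′ n (λ i → trans (ZP.*-distribʳ-+ (G (n N.∸ i)) (when (i ≡ᵇ 0) (+ 1)) (when (i ≡ᵇ suc j) c))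
                               (cong₂ _+_ (when-*ˡ (i ≡ᵇ 0) (+ 1) (G (n N.∸ i))) (when-*ˡ (i ≡ᵇ suc j) c (G (n N.∸ i))))) ⟩
    sumTo n (λ i → when (i ≡ᵇ 0) (+ 1 * G (n N.∸ i)) + when (i ≡ᵇ suc j) (c * G (n N.∸ i)))
  ≡⟨ sumTo-+ n _ _ ⟩
    sumTo n (λ i → when (i ≡ᵇ 0) (+ 1 * G (n N.∸ i))) + sumTo n (λ i → when (i ≡ᵇ suc j) (c * G (n N.∸ i)))
  ≡⟨ cong₂ _+_ (sumTo-when-≡ᵇ n 0 (λ i → + 1 * G (n N.∸ i))) (sumTo-when-≡ᵇ n (suc j) (λ i → c * G (n N.∸ i))) ⟩
    + 1 * G n + when (suc j ≤ᵇ n) (c * G (n N.∸ suc j))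
  ≡⟨ cong (_+ when (suc j ≤ᵇ n) (c * G (n N.∸ suc j))) (ZP.*-identityˡ (G n)) ⟩
    G n + when (suc j ≤ᵇ n) (c * G (n N.∸ suc j)) ∎
  where open ≡-Reasoning

-- Congruences of power series

*-pres-∣ : ∀ {a b x y} → a ZD.∣ x → b ZD.∣ y → a * b ZD.∣ x * y
*-pres-∣ {a} {b} (ZD.divides q refl) (ZD.divides r refl) = ZD.divides (q * r) (regroup q a r b)
  where
  open import Data.Integer.Tactic.RingSolver using (solve-∀)
  regroup : ∀ q a r b → q * a * (r * b) ≡ q * r * (a * b)
  regroup = solve-∀

sumTo-∣ : ∀ m n f → (∀ i → i ≤ n → m ZD.∣ f i) → m ZD.∣ sumTo n f
sumTo-∣ m zero    f m∣f = m∣f 0 z≤n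
sumTo-∣ m (suc n) f m∣f =
  ZD.∣m∣n⇒∣m+n (sumTo-∣ m n f (λ i i≤n → m∣f i (NP.m≤n⇒m≤1+n i≤n))) (m∣f (suc n) NP.≤-refl)

infix 4 _∣ₛ_
record _∣ₛ_ (m : ℤ) (f : PS) : Set where
  constructor mk∣ₛ
  field coeff-∣ : ∀ n → m ZD.∣ f n
open _∣ₛ_

mul-pres-∣ₛ : ∀ {a b f g} → a ∣ₛ f → b ∣ₛ g → a * b ∣ₛ mul f g
mul-pres-∣ₛ a∣f b∣g = mk∣ₛ λ n → sumTo-∣ _ n _ (λ i _ → *-pres-∣ (coeff-∣ a∣f i) (coeff-∣ b∣g (n N.∸ i)))

∣ₛ-mulʳ : ∀ {a f} g → a ∣ₛ f → a ∣ₛ mul f g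
∣ₛ-mulʳ g a∣f = mk∣ₛ λ n → sumTo-∣ _ n _ (λ i _ → ZD.∣m⇒∣m*n (g (n N.∸ i)) (coeff-∣ a∣f i))

∣ₛ-mulˡ : ∀ {a} f {g} → a ∣ₛ g → a ∣ₛ mul f g
∣ₛ-mulˡ f a∣g = mk∣ₛ λ n → sumTo-∣ _ n _ (λ i _ → ZD.∣n⇒∣m*n (f i) (coeff-∣ a∣g (n N.∸ i)))

∣ₛ-add : ∀ {a f g} → a ∣ₛ f → a ∣ₛ g → a ∣ₛ addPS f g
∣ₛ-add a∣f a∣g = mk∣ₛ λ n → ZD.∣m∣n⇒∣m+n (coeff-∣ a∣f n) (coeff-∣ a∣g n)

∣ₛ-resp-≈ : ∀ {a f g} → f ≈ g → a ∣ₛ f → a ∣ₛ g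
∣ₛ-resp-≈ f≈g a∣f = mk∣ₛ λ n → subst (_ ZD.∣_) (at f≈g n) (coeff-∣ a∣f n)

∣ₛ-constant : ∀ c f → c ∣ₛ mul (constant c) f
∣ₛ-constant c f = mk∣ₛ λ n → subst (c ZD.∣_) (sym (mul-constantˡ c f n)) (ZD.∣m⇒∣m*n (f n) ZD.∣-refl)

infix 4 _≡[_]_
record _≡[_]_ (f : PS) (m : ℤ) (g : PS) : Set where
  constructor mk≡[]
  field difference-∣ : m ∣ₛ addPS f (negPS g)
open _≡[_]_

coeff-≡[] : ∀ {m f g} → f ≡[ m ] g → ∀ n → m ZD.∣ f n - g n
coeff-≡[] f≡g = coeff-∣ (difference-∣ f≡g)

≈⇒≡[] : ∀ {m f g} → f ≈ g → f ≡[ m ] g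
≈⇒≡[] {m} {f} {g} f≈g = mk≡[] (mk∣ₛ λ n →
  subst (m ZD.∣_) (trans (sym (ZP.+-inverseʳ (f n))) (cong (λ z → f n - z) (at f≈g n))) (ZD.divides (+ 0) refl))

≡[]-refl : ∀ {m f} → f ≡[ m ] f
≡[]-refl = ≈⇒≡[] ≈-refl

≡[]-sym : ∀ {m f g} → f ≡[ m ] g → g ≡[ m ] f
≡[]-sym {m} {f} {g} f≡g = mk≡[] (mk∣ₛ λ n → subst (m ZD.∣_) (negate-difference (f n) (g n)) (ZD.∣m⇒∣-m (coeff-≡[] f≡g n)))
  where
  open import Data.Integer.Tactic.RingSolver using (solve-∀)
  negate-difference : ∀ a b → - (a - b) ≡ b - a
  negate-difference = solve-∀

≡[]-trans : ∀ {m f g h} → f ≡[ m ] g → g ≡[ m ] h → f ≡[ m ] h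
≡[]-trans {m} {f} {g} {h} f≡g g≡h =
  mk≡[] (∣ₛ-resp-≈ (mk≈ λ n → telescope (f n) (g n) (h n)) (∣ₛ-add (difference-∣ f≡g) (difference-∣ g≡h)))
  where
  open import Data.Integer.Tactic.RingSolver using (solve-∀)
  telescope : ∀ a b c → (a - b) + (b - c) ≡ a - c
  telescope = solve-∀

≡[]-setoid : ℤ → Setoid _ _
≡[]-setoid m = record
  { Carrier = PS
  ; _≈_ = _≡[ m ]_
  ; isEquivalence = record { refl = ≡[]-refl ; sym = ≡[]-sym ; trans = ≡[]-trans } }

module ≡[]-Reasoning (m : ℤ) = SetoidReasoning (≡[]-setoid m)

≡[]-weaken : ∀ {a b f g} → a ZD.∣ b → f ≡[ b ] g → f ≡[ a ] g
≡[]-weaken a∣b f≡g = mk≡[] (mk∣ₛ λ n → ZD.∣-trans a∣b (coeff-≡[] f≡g n))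

≡[]-add : ∀ {m f f′ g g′} → f ≡[ m ] f′ → g ≡[ m ] g′ → addPS f g ≡[ m ] addPS f′ g′
≡[]-add {m} {f} {f′} {g} {g′} f≡f′ g≡g′ =
  mk≡[] (∣ₛ-resp-≈ (mk≈ λ n → regroup (f n) (f′ n) (g n) (g′ n)) (∣ₛ-add (difference-∣ f≡f′) (difference-∣ g≡g′)))
  where
  open import Data.Integer.Tactic.RingSolver using (solve-∀)
  regroup : ∀ a b c d → (a - b) + (c - d) ≡ (a + c) - (b + d)
  regroup = solve-∀

≡[]-mulʳ : ∀ {m f f′} g → f ≡[ m ] f′ → mul f g ≡[ m ] mul f′ g
≡[]-mulʳ {m} {f} {f′} g f≡f′ = mk≡[] (∣ₛ-resp-≈ distrib (∣ₛ-mulʳ g (difference-∣ f≡f′)))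
  where
  distrib : mul (addPS f (negPS f′)) g ≈ addPS (mul f g) (negPS (mul f′ g))
  distrib = solve 3 (λ f f′ g → (f :- f′) :* g := f :* g :- f′ :* g) ≈-refl f f′ g

≡[]-mulˡ : ∀ {m} f {g g′} → g ≡[ m ] g′ → mul f g ≡[ m ] mul f g′
≡[]-mulˡ {m} f {g} {g′} g≡g′ = mk≡[] (∣ₛ-resp-≈ distrib (∣ₛ-mulˡ f (difference-∣ g≡g′)))
  where
  distrib : mul f (addPS g (negPS g′)) ≈ addPS (mul f g) (negPS (mul f g′))
  distrib = solve 3 (λ f g g′ → f :* (g :- g′) := f :* g :- f :* g′) ≈-refl f g g′

≡[]-mul : ∀ {m f f′ g g′} → f ≡[ m ] f′ → g ≡[ m ] g′ → mul f g ≡[ m ] mul f′ g′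
≡[]-mul {f′ = f′} {g = g} f≡f′ g≡g′ = ≡[]-trans (≡[]-mulʳ g f≡f′) (≡[]-mulˡ f′ g≡g′)

≡[]-pow : ∀ {m f f′} r → f ≡[ m ] f′ → pow f r ≡[ m ] pow f′ r
≡[]-pow zero    f≡f′ = ≡[]-refl
≡[]-pow (suc r) f≡f′ = ≡[]-mul f≡f′ (≡[]-pow r f≡f′)

≡[]-cancelʳ : ∀ {m X Y u v} → mul u v ≈ one → mul X u ≡[ m ] mul Y u → X ≡[ m ] Y
≡[]-cancelʳ {m} {X} {Y} {u} {v} uv≈1 Xu≡Yu = begin
    X
  ≈⟨ ≈⇒≡[] (unit X) ⟩
    mul (mul X u) v
  ≈⟨ ≡[]-mulʳ v Xu≡Yu ⟩
    mul (mul Y u) v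
  ≈⟨ ≈⇒≡[] (≈-sym (unit Y)) ⟩
    Y ∎
  where
  open ≡[]-Reasoning m
  unit : ∀ Z → Z ≈ mul (mul Z u) v
  unit Z = ≈-trans (≈-sym (mul-identityʳ Z))
           (≈-trans (mul-cong (≈-refl {Z}) (≈-sym uv≈1)) (mk≈ λ n → sym (mul-assoc Z u v n)))

+-pres-∣ : ∀ {a b} → a ∣ b → + a ZD.∣ + b
+-pres-∣ (NDiv.divides q refl) = ZD.divides (+ q) (ZP.pos-* q _)

≡[]-cong-mod : ∀ {a b f g} → a ≡ b → f ≡[ a ] g → f ≡[ b ] g
≡[]-cong-mod refl f≡g = f≡g

geomSum : PS → PS → ℕ → PS
geomSum X Y zero    = zeroPS
geomSum X Y (suc n) = addPS (mul X (geomSum X Y n)) (pow Y n)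

pow-difference : ∀ X Y n → addPS (pow X n) (negPS (pow Y n)) ≈ mul (addPS X (negPS Y)) (geomSum X Y n)
pow-difference X Y zero    = mk≈ λ n →
  trans (ZP.+-inverseʳ (one n)) (sym (trans (mul-comm (addPS X (negPS Y)) zeroPS n) (sumTo-vanishing n (λ i _ → refl))))
pow-difference X Y (suc n) = ≈-sym (begin
    mul (addPS X (negPS Y)) (addPS (mul X S) B)
  ≈⟨ solve 4 (λ X Y S B → (X :- Y) :* (X :* S :+ B) := X :* ((X :- Y) :* S) :+ (X :- Y) :* B) ≈-refl X Y S B ⟩
    addPS (mul X (mul (addPS X (negPS Y)) S)) (mul (addPS X (negPS Y)) B)
  ≈⟨ mk≈ (λ k → cong (_+ mul (addPS X (negPS Y)) B k) (at (mul-cong (≈-refl {X}) (≈-sym (pow-difference X Y n))) k)) ⟩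
    addPS (mul X (addPS A (negPS B))) (mul (addPS X (negPS Y)) B)
  ≈⟨ solve 4 (λ X Y A B → X :* (A :- B) :+ (X :- Y) :* B := X :* A :- Y :* B) ≈-refl X Y A B ⟩
    addPS (mul X A) (negPS (mul Y B)) ∎)
  where
  open ≈-Reasoning
  A = pow X n
  B = pow Y n
  S = geomSum X Y n

geomSum-≡[] : ∀ {m} X Y n → X ≡[ m ] Y → geomSum X Y (suc n) ≡[ m ] mul (constant (+ suc n)) (pow Y n)
geomSum-≡[] X Y zero    X≡Y = ≈⇒≡[] (mk≈ λ n →
  trans (cong (_+ one n) (trans (mul-comm X zeroPS n) (sumTo-vanishing n (λ i _ → refl))))
        (trans (ZP.+-identityˡ (one n)) (sym (trans (mul-constantˡ (+ 1) one n) (ZP.*-identityˡ (one n))))))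
geomSum-≡[] X Y (suc n) X≡Y =
  ≡[]-trans (≡[]-add (≡[]-mul X≡Y (geomSum-≡[] X Y n X≡Y)) ≡[]-refl) (≈⇒≡[] collect)
  where
  B = pow Y n
  collect : addPS (mul Y (mul (constant (+ suc n)) B)) (mul Y B) ≈ mul (constant (+ suc (suc n))) (mul Y B)
  collect = ≈-trans
    (solve 3 (λ Y c B → Y :* (c :* B) :+ Y :* B := c :* (Y :* B) :+ Y :* B) ≈-refl Y (constant (+ suc n)) B)
    (mk≈ λ k → trans (cong (_+ mul Y B k) (mul-constantˡ (+ suc n) (mul Y B) k))
                     (sym (trans (mul-constantˡ (+ suc (suc n)) (mul Y B) k) (suc-* (+ suc n) (mul Y B k)))))
    where
    open import Data.Integer.Tactic.RingSolver using (solve-∀)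
    suc-* : ∀ c z → (+ 1 + c) * z ≡ c * z + z
    suc-* = solve-∀

-- X^n - Y^n = (X - Y) · geomSum X Y n, and X ≡ Y (mod n) gives geomSum X Y n ≡ n Y^(n-1) ≡ 0 (mod n).
pow-lift : ∀ {m} n X Y → X ≡[ + n ] Y → X ≡[ m ] Y → pow X n ≡[ m * + n ] pow Y n
pow-lift zero        X Y _   _   = ≡[]-refl
pow-lift {m} (suc n) X Y X≡Y X≡Yₘ =
  mk≡[] (∣ₛ-resp-≈ (≈-sym (pow-difference X Y (suc n))) (mul-pres-∣ₛ (difference-∣ X≡Yₘ) n+1∣geomSum))
  where
  n+1∣geomSum : + suc n ∣ₛ geomSum X Y (suc n)
  n+1∣geomSum = ∣ₛ-resp-≈ (mk≈ λ k → sub-add _ _)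
    (∣ₛ-add (difference-∣ (geomSum-≡[] X Y n X≡Y)) (∣ₛ-constant (+ suc n) (pow Y n)))
    where
    open import Data.Integer.Tactic.RingSolver using (solve-∀)
    sub-add : ∀ a b → (a - b) + b ≡ a
    sub-add = solve-∀

pow-^-lift : ∀ p X Y → X ≡[ + p ] Y → ∀ j → pow X (p ^ j) ≡[ + (p ^ suc j) ] pow Y (p ^ j)
pow-^-lift p X Y X≡Y zero =
  ≡[]-trans (≈⇒≡[] (mul-identityʳ X))
    (≡[]-trans (≡[]-cong-mod (cong +_ (sym (NP.*-identityʳ p))) X≡Y) (≈⇒≡[] (≈-sym (mul-identityʳ Y))))
pow-^-lift p X Y X≡Y (suc j) =
  ≡[]-trans (≈⇒≡[] (pow-*′ X))
    (≡[]-trans (≡[]-cong-mod modulus (pow-lift p (pow X (p ^ j)) (pow Y (p ^ j)) X′≡Y′ (pow-^-lift p X Y X≡Y j)))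
               (≈⇒≡[] (≈-sym (pow-*′ Y))))
  where
  pow-*′ : ∀ Z → pow Z (p N.* p ^ j) ≈ pow (pow Z (p ^ j)) p
  pow-*′ Z = subst (λ k → pow Z k ≈ pow (pow Z (p ^ j)) p) (NP.*-comm (p ^ j) p) (pow-* Z (p ^ j) p)
  X′≡Y′ : pow X (p ^ j) ≡[ + p ] pow Y (p ^ j)
  X′≡Y′ = ≡[]-weaken (+-pres-∣ (NDiv.m∣m*n (p ^ j))) (pow-^-lift p X Y X≡Y j)
  modulus : + (p ^ suc j) * + p ≡ + (p ^ suc (suc j))
  modulus = trans (sym (ZP.pos-* (p ^ suc j) p)) (cong +_ (NP.*-comm (p ^ suc j) p))

-- Dilation q ↦ q^d

[c*d+r]%d≡r : ∀ d c r → r < suc d → (c N.* suc d N.+ r) % suc d ≡ r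
[c*d+r]%d≡r d c r r<d = trans (ND.%-remove-+ˡ r (NDiv.n∣m*n c)) (ND.m<n⇒m%n≡m r<d)

[c*d+r]/d≡c : ∀ d c r → r < suc d → (c N.* suc d N.+ r) / suc d ≡ c
[c*d+r]/d≡c d c r r<d =
  trans (ND.+-distrib-/-∣ˡ r (NDiv.n∣m*n c))
        (trans (cong₂ N._+_ (ND.m*n/n≡m c (suc d)) (ND.m<n⇒m/n≡0 r<d)) (NP.+-identityʳ c))

division-ind : ∀ d (P : ℕ → Set) → (∀ c r → r < suc d → P (c N.* suc d N.+ r)) → ∀ n → P n
division-ind d P P-case n = subst P (sym n≡) (P-case (n / suc d) (n % suc d) (ND.m%n<n n (suc d)))
  where
  n≡ : n ≡ (n / suc d) N.* suc d N.+ n % suc d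
  n≡ = trans (ND.m≡m%n+[m/n]*n n (suc d)) (NP.+-comm (n % suc d) _)

dilate-at : ∀ d (f : PS) c r → r < suc d → dilate (suc d) f (c N.* suc d N.+ r) ≡ when (r ≡ᵇ 0) (f c)
dilate-at d f c r r<d rewrite [c*d+r]%d≡r d c r r<d | [c*d+r]/d≡c d c r r<d = refl

dilate-cong : ∀ d {f g} → f ≈ g → dilate (suc d) f ≈ dilate (suc d) g
dilate-cong d {f} {g} f≈g = mk≈ λ n → cong (λ z → if n % suc d ≡ᵇ 0 then z else + 0) (at f≈g (n / suc d))

dilate-binomialQ : ∀ d c → dilate (suc d) (binomialQ 0 c) ≈ binomialQ d c
dilate-binomialQ d c = mk≈ (division-ind d (λ n → dilate (suc d) (binomialQ 0 c) n ≡ binomialQ d c n) coeff)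
  where
  D = suc d
  coeff : ∀ q r → r < D → dilate D (binomialQ 0 c) (q N.* D N.+ r) ≡ binomialQ d c (q N.* D N.+ r)
  coeff q (suc r) r<D
    rewrite dilate-at d (binomialQ 0 c) q (suc r) r<D
          | ≡ᵇ-false {q N.* D N.+ suc r} {0} (λ e → NP.0≢1+n (sym (trans (sym (NP.+-suc (q N.* D) r)) e)))
          | ≡ᵇ-false {q N.* D N.+ suc r} {D} (λ e → NP.0≢1+n (sym (trans (sym ([c*d+r]%d≡r d q (suc r) r<D))
                                                                         (trans (cong (_% D) e) (ND.n%n≡0 D))))) = refl
  coeff zero          zero r<D = refl
  coeff (suc zero)    zero r<D
    rewrite dilate-at d (binomialQ 0 c) 1 0 r<D | ≡ᵇ-true {d N.+ 0 N.+ 0} {d} (trans (NP.+-identityʳ _) (NP.+-identityʳ d)) = refl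
  coeff (suc (suc q)) zero r<D
    rewrite dilate-at d (binomialQ 0 c) (suc (suc q)) zero r<D
          | ≡ᵇ-false {suc (suc q) N.* D N.+ 0} {D} (λ e → NP.0≢1+n (sym (NP.+-cancelˡ-≡ D _ 0
              (trans (sym (NP.+-identityʳ _)) (trans e (sym (NP.+-identityʳ D))))))) = refl

dilate-oneMinusQ : ∀ d → dilate (suc d) (oneMinusQ 0) ≈ oneMinusQ d
dilate-oneMinusQ d =
  ≈-trans (dilate-cong d (oneMinusQ≈binomialQ 0)) (≈-trans (dilate-binomialQ d (- + 1)) (≈-sym (oneMinusQ≈binomialQ d)))

dilate-≡[] : ∀ d {m f g} → f ≡[ m ] g → dilate (suc d) f ≡[ m ] dilate (suc d) g
dilate-≡[] d {m} {f} {g} f≡g = mk≡[] (mk∣ₛ λ n →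
  when-∣ (n % suc d ≡ᵇ 0) (f (n / suc d)) (g (n / suc d)) (coeff-≡[] f≡g (n / suc d)))
  where
  when-∣ : ∀ b x y → m ZD.∣ x - y → m ZD.∣ when b x - when b y
  when-∣ true  x y m∣x-y = m∣x-y
  when-∣ false x y _     = ZD.divides (+ 0) refl

dilate-one : ∀ d → dilate (suc d) one ≈ one
dilate-one d = mk≈ (division-ind d (λ n → dilate (suc d) one n ≡ one n) coeff)
  where
  coeff : ∀ c r → r < suc d → dilate (suc d) one (c N.* suc d N.+ r) ≡ one (c N.* suc d N.+ r)
  coeff c       (suc r) r<D rewrite dilate-at d one c (suc r) r<D | NP.+-suc (c N.* suc d) r = refl
  coeff zero    zero    r<D = refl
  coeff (suc c) zero    r<D rewrite dilate-at d one (suc c) 0 r<D = refl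

dilate-1 : ∀ f → dilate 1 f ≈ f
dilate-1 f = mk≈ λ n → trans (cong (λ z → if z ≡ᵇ 0 then f (n / 1) else + 0) (ND.n%1≡0 n)) (cong f (ND.n/1≡n n))

sumTo-dilate : ∀ d (f X : ℕ → ℤ) N →
               sumTo (N N.* suc d N.+ d) (λ i → dilate (suc d) f i * X i) ≡ sumTo N (λ c → f c * X (c N.* suc d))
sumTo-dilate d f X zero = sumTo-extend′ 0 d _ z≤n (λ { (suc i) _ i≤d →
  trans (cong (_* X (suc i)) (dilate-at d f 0 (suc i) (s≤s i≤d))) (ZP.*-zeroˡ (X (suc i))) })
sumTo-dilate d f X (suc N) = begin
    sumTo (suc N N.* D N.+ d) F
  ≡⟨ cong (λ k → sumTo k F) (NP.+-assoc D (N N.* D) d) ⟩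
    sumTo (D N.+ (N N.* D N.+ d)) F
  ≡⟨ sumTo-split d (N N.* D N.+ d) F ⟩
    sumTo (N N.* D N.+ d) F + sumTo d (λ i → F (suc (i N.+ (N N.* D N.+ d))))
  ≡⟨ cong₂ _+_ (sumTo-dilate d f X N) (sumTo-cong′ d (λ i → cong F (reindex i N d))) ⟩
    sumTo N (λ c → f c * X (c N.* D)) + sumTo d (λ i → F (suc N N.* D N.+ i))
  ≡⟨ cong (_+_ (sumTo N (λ c → f c * X (c N.* D)))) lastBlock ⟩
    sumTo (suc N) (λ c → f c * X (c N.* D)) ∎
  where
  open ≡-Reasoning
  D = suc d
  F = λ i → dilate D f i * X i
  reindex : ∀ i N d → suc (i N.+ (N N.* suc d N.+ d)) ≡ suc N N.* suc d N.+ i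
  reindex = solve-∀
    where open import Data.Nat.Tactic.RingSolver using (solve-∀)
  lastBlock : sumTo d (λ i → F (suc N N.* D N.+ i)) ≡ f (suc N) * X (suc N N.* D)
  lastBlock = begin
      sumTo d (λ i → F (suc N N.* D N.+ i))
    ≡⟨ sumTo-extend′ 0 d _ z≤n (λ { (suc i) _ i≤d →
         trans (cong (_* X (suc N N.* D N.+ suc i)) (dilate-at d f (suc N) (suc i) (s≤s i≤d)))
               (ZP.*-zeroˡ (X (suc N N.* D N.+ suc i))) }) ⟩
      F (suc N N.* D N.+ 0)
    ≡⟨ cong₂ _*_ (dilate-at d f (suc N) 0 (s≤s z≤n)) (cong X (NP.+-identityʳ _)) ⟩
      f (suc N) * X (suc N N.* D) ∎

dilated-+≡ᵇ : ∀ d c e Q R → R < suc d →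
  when (c N.* suc d N.+ e N.* suc d ≡ᵇ Q N.* suc d N.+ R) (+ 1) ≡ when (R ≡ᵇ 0) (when (c N.+ e ≡ᵇ Q) (+ 1))
dilated-+≡ᵇ d c e Q zero    R<D = cong (λ b → when b (+ 1)) (≡ᵇ-cong-⇔
  (λ eq → NP.*-cancelʳ-≡ (c N.+ e) Q (suc d) (trans (NP.*-distribʳ-+ (suc d) c e) (trans eq (NP.+-identityʳ _))))
  (λ eq → trans (sym (NP.*-distribʳ-+ (suc d) c e)) (trans (cong (N._* suc d) eq) (sym (NP.+-identityʳ _)))))
dilated-+≡ᵇ d c e Q (suc r) R<D = when-false (+ 1) (≡ᵇ-false λ eq →
  NP.0≢1+n (trans (sym (ND.m*n%n≡0 (c N.+ e) (suc d)))
             (trans (cong (_% suc d) (trans (NP.*-distribʳ-+ (suc d) c e) eq)) ([c*d+r]%d≡r d Q (suc r) R<D))))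

dilate-mul : ∀ d f g → dilate (suc d) (mul f g) ≈ mul (dilate (suc d) f) (dilate (suc d) g)
dilate-mul d f g = mk≈ (division-ind d (λ n → dilate (suc d) (mul f g) n ≡ mul df dg n) coeff)
  where
  D = suc d
  df = dilate D f
  dg = dilate D g
  coeff : ∀ Q R → R < D → dilate D (mul f g) (Q N.* D N.+ R) ≡ mul df dg (Q N.* D N.+ R)
  coeff Q R R<D = sym (begin
      mul df dg n
    ≡⟨ mul-as-double-sum df dg n B n≤B ⟩
      sumTo B (λ i → sumTo B (λ j → when (i N.+ j ≡ᵇ n) (df i * dg j)))
    ≡⟨ sumTo-cong′ B (λ i → trans (sumTo-cong′ B (λ j → when-as-* (i N.+ j ≡ᵇ n) (df i) (dg j))) (sumTo-*ˡ B (df i) _)) ⟩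
      sumTo B (λ i → df i * sumTo B (λ j → dg j * when (i N.+ j ≡ᵇ n) (+ 1)))
    ≡⟨ sumTo-dilate d f (λ i → sumTo B (λ j → dg j * when (i N.+ j ≡ᵇ n) (+ 1))) n ⟩
      sumTo n (λ c → f c * sumTo B (λ j → dg j * when (c N.* D N.+ j ≡ᵇ n) (+ 1)))
    ≡⟨ sumTo-cong′ n (λ c → cong (f c *_) (sumTo-dilate d g (λ j → when (c N.* D N.+ j ≡ᵇ n) (+ 1)) n)) ⟩
      sumTo n (λ c → f c * sumTo n (λ e → g e * when (c N.* D N.+ e N.* D ≡ᵇ n) (+ 1)))
    ≡⟨ sumTo-cong′ n (λ c → trans (sym (sumTo-*ˡ n (f c) _))
                                   (sumTo-cong′ n (λ e → cong (λ z → f c * (g e * z)) (dilated-+≡ᵇ d c e Q R R<D)))) ⟩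
      sumTo n (λ c → sumTo n (λ e → f c * (g e * when (R ≡ᵇ 0) (when (c N.+ e ≡ᵇ Q) (+ 1)))))
    ≡⟨ sumTo-cong′ n (λ c → sumTo-cong′ n (λ e → when-when-as-* (R ≡ᵇ 0) (c N.+ e ≡ᵇ Q) (f c) (g e))) ⟨
      sumTo n (λ c → sumTo n (λ e → when (R ≡ᵇ 0) (when (c N.+ e ≡ᵇ Q) (f c * g e))))
    ≡⟨ trans (when-sumTo (R ≡ᵇ 0) n _) (sumTo-cong′ n (λ c → when-sumTo (R ≡ᵇ 0) n _)) ⟨
      when (R ≡ᵇ 0) (sumTo n (λ c → sumTo n (λ e → when (c N.+ e ≡ᵇ Q) (f c * g e))))
    ≡⟨ cong (when (R ≡ᵇ 0)) (mul-as-double-sum f g Q n Q≤n) ⟨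
      when (R ≡ᵇ 0) (mul f g Q)
    ≡⟨ dilate-at d (mul f g) Q R R<D ⟨
      dilate D (mul f g) (Q N.* D N.+ R) ∎)
    where
    open ≡-Reasoning
    n = Q N.* D N.+ R
    B = n N.* D N.+ d
    n≤B : n ≤ B
    n≤B = NP.≤-trans (NP.m≤m*n n D) (NP.m≤m+n _ d)
    Q≤n : Q ≤ n
    Q≤n = NP.≤-trans (NP.m≤m*n Q D) (NP.m≤m+n _ R)

dilate-pow : ∀ d f r → dilate (suc d) (pow f r) ≈ pow (dilate (suc d) f) r
dilate-pow d f zero    = dilate-one d
dilate-pow d f (suc r) = ≈-trans (dilate-mul d f (pow f r)) (mul-cong (≈-refl {dilate (suc d) f}) (dilate-pow d f r))

dilate-dilate : ∀ a b f → dilate (suc a) (dilate (suc b) f) ≈ dilate (suc a N.* suc b) f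
dilate-dilate a b f = mk≈ (division-ind d (λ n → dilate A (dilate B f) n ≡ dilate (suc d) f n) coeff)
  where
  A = suc a
  B = suc b
  d = b N.+ a N.* suc b
  coeff : ∀ Q R → R < suc d → dilate A (dilate B f) (Q N.* suc d N.+ R) ≡ dilate (suc d) f (Q N.* suc d N.+ R)
  coeff Q = division-ind a (λ R → R < suc d → dilate A (dilate B f) (Q N.* suc d N.+ R) ≡ dilate (suc d) f (Q N.* suc d N.+ R))
                         coeff′
    where
    coeff′ : ∀ q r → r < A → q N.* A N.+ r < suc d →
             dilate A (dilate B f) (Q N.* suc d N.+ (q N.* A N.+ r)) ≡ dilate (suc d) f (Q N.* suc d N.+ (q N.* A N.+ r))
    coeff′ q r r<A q*A+r<AB = begin
        dilate A (dilate B f) (Q N.* suc d N.+ (q N.* A N.+ r))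
      ≡⟨ cong (dilate A (dilate B f)) (regroup Q a b q r) ⟩
        dilate A (dilate B f) ((Q N.* B N.+ q) N.* A N.+ r)
      ≡⟨ dilate-at a (dilate B f) (Q N.* B N.+ q) r r<A ⟩
        when (r ≡ᵇ 0) (dilate B f (Q N.* B N.+ q))
      ≡⟨ cong (when (r ≡ᵇ 0)) (dilate-at b f Q q q<B) ⟩
        when (r ≡ᵇ 0) (when (q ≡ᵇ 0) (f Q))
      ≡⟨ both-zero q r ⟨
        when (q N.* A N.+ r ≡ᵇ 0) (f Q)
      ≡⟨ dilate-at d f Q (q N.* A N.+ r) q*A+r<AB ⟨
        dilate (suc d) f (Q N.* suc d N.+ (q N.* A N.+ r)) ∎
      where
      open ≡-Reasoning
      regroup : ∀ Q a b q r → Q N.* suc (b N.+ a N.* suc b) N.+ (q N.* suc a N.+ r) ≡ (Q N.* suc b N.+ q) N.* suc a N.+ r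
      regroup = solve-∀
        where open import Data.Nat.Tactic.RingSolver using (solve-∀)
      q<B : q < B
      q<B = NP.≰⇒> λ B≤q → NP.<⇒≱ q*A+r<AB
        (NP.≤-trans (NP.≤-reflexive (NP.*-comm A B)) (NP.≤-trans (NP.*-monoˡ-≤ A B≤q) (NP.m≤m+n _ r)))
      both-zero : ∀ q r → when (q N.* A N.+ r ≡ᵇ 0) (f Q) ≡ when (r ≡ᵇ 0) (when (q ≡ᵇ 0) (f Q))
      both-zero q       (suc r) rewrite NP.+-suc (q N.* A) r = refl
      both-zero zero    zero    = refl
      both-zero (suc q) zero    = refl

dilate-dilate′ : ∀ a b {c} f → suc a N.* suc b ≡ c → dilate (suc a) (dilate (suc b) f) ≈ dilate c f
dilate-dilate′ a b f refl = dilate-dilate a b f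

dilate-dilate-comm : ∀ a b f → dilate (suc a) (dilate (suc b) f) ≈ dilate (suc b) (dilate (suc a) f)
dilate-dilate-comm a b f = ≈-trans (dilate-dilate′ a b f (NP.*-comm (suc a) (suc b))) (≈-sym (dilate-dilate b a f))

dilate-dilate-nonzero : ∀ a m f → 0 < m → dilate (suc a) (dilate m f) ≈ dilate (suc a N.* m) f
dilate-dilate-nonzero a (suc b) f _ = dilate-dilate a b f

dilate-pow-nonzero : ∀ D f r → 0 < D → dilate D (pow f r) ≈ pow (dilate D f) r
dilate-pow-nonzero (suc d) f r _ = dilate-pow d f r

-- The Frobenius congruence for 1 - q

absorption : ∀ n t → suc t N.* (suc n C suc t) ≡ suc n N.* (n C t)
absorption zero    zero    = refl
absorption zero    (suc t) = NP.*-zeroʳ (suc (suc t))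
absorption (suc n) zero    = trans (NP.*-identityˡ _) (trans (nC1≡n (suc (suc n))) (sym (NP.*-identityʳ (suc (suc n)))))
absorption (suc n) (suc t) = begin
    suc (suc t) N.* (suc (suc n) C suc (suc t))
  ≡⟨ cong (suc (suc t) N.*_) (nCk+nC[k+1]≡[n+1]C[k+1] (suc n) (suc t)) ⟨
    suc (suc t) N.* (suc n C suc t N.+ suc n C suc (suc t))
  ≡⟨ NP.*-distribˡ-+ (suc (suc t)) (suc n C suc t) (suc n C suc (suc t)) ⟩
    suc (suc t) N.* (suc n C suc t) N.+ suc (suc t) N.* (suc n C suc (suc t))
  ≡⟨ cong₂ N._+_ (cong (suc n C suc t N.+_) (absorption n t)) (absorption n (suc t)) ⟩
    suc n C suc t N.+ suc n N.* (n C t) N.+ suc n N.* (n C suc t)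
  ≡⟨ regroup (suc n C suc t) (suc n) (n C t) (n C suc t) ⟩
    suc n C suc t N.+ suc n N.* (n C t N.+ n C suc t)
  ≡⟨ cong (λ x → suc n C suc t N.+ suc n N.* x) (nCk+nC[k+1]≡[n+1]C[k+1] n t) ⟩
    suc (suc n) N.* (suc n C suc t) ∎
  where
  open ≡-Reasoning
  regroup : ∀ a b c d → a N.+ b N.* c N.+ b N.* d ≡ a N.+ b N.* (c N.+ d)
  regroup = solve-∀
    where open import Data.Nat.Tactic.RingSolver using (solve-∀)

prime∣C : ∀ p t → Prime p → 0 < t → t < p → p ∣ p C t
prime∣C (suc n) (suc t) p-prime _ t<p
  with euclidsLemma (suc t) (suc n C suc t) p-prime
         (subst (suc n ∣_) (sym (absorption n t)) (NDiv.∣m⇒∣m*n (n C t) NDiv.∣-refl))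
... | inj₁ p∣t+1 = ⊥-elim (NP.<⇒≱ t<p (NDiv.∣⇒≤ p∣t+1))
... | inj₂ p∣C   = p∣C

sign : ℕ → ℤ
sign zero    = + 1
sign (suc t) = - sign t

sign-odd : ∀ n → n % 2 ≡ 1 → sign n ≡ - + 1
sign-odd n n-odd = subst (λ k → sign k ≡ - + 1) (sym n≡) (sign-2k+1 (n / 2))
  where
  sign-2k+1 : ∀ k → sign (suc (k N.* 2)) ≡ - + 1
  sign-2k+1 zero    = refl
  sign-2k+1 (suc k) = trans (ZP.neg-involutive _) (sign-2k+1 k)
  n≡ : n ≡ suc ((n / 2) N.* 2)
  n≡ = trans (ND.m≡m%n+[m/n]*n n 2) (cong (N._+ (n / 2) N.* 2) n-odd)

coeff-pow-oneMinusQ : ∀ n t → pow (oneMinusQ 0) n t ≡ sign t * + (n C t)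
coeff-pow-oneMinusQ zero    zero    = refl
coeff-pow-oneMinusQ zero    (suc t) = sym (ZP.*-zeroʳ (sign (suc t)))
coeff-pow-oneMinusQ (suc n) t =
  trans (at (mul-cong (oneMinusQ≈binomialQ 0) (≈-refl {pow (oneMinusQ 0) n})) t)
        (trans (mul-binomialQ 0 (- + 1) (pow (oneMinusQ 0) n) t) (pascal t))
  where
  pascal : ∀ t → pow (oneMinusQ 0) n t + when (1 ≤ᵇ t) (- + 1 * pow (oneMinusQ 0) n (t N.∸ 1))
                 ≡ sign t * + (suc n C t)
  pascal zero rewrite coeff-pow-oneMinusQ n 0 = refl
  pascal (suc t)
    rewrite coeff-pow-oneMinusQ n (suc t) | coeff-pow-oneMinusQ n t
          | sym (nCk+nC[k+1]≡[n+1]C[k+1] n t) | ZP.pos-+ (n C t) (n C suc t) =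
    regroup (sign t) (+ (n C t)) (+ (n C suc t))
    where
    open import Data.Integer.Tactic.RingSolver using (solve-∀)
    regroup : ∀ s a b → - s * b + - + 1 * (s * a) ≡ - s * (a + b)
    regroup = solve-∀

frobenius-oneMinusQ : ∀ p → Prime (suc p) → suc p % 2 ≡ 1 → pow (oneMinusQ 0) (suc p) ≡[ + suc p ] oneMinusQ p
frobenius-oneMinusQ p p-prime p-odd = mk≡[] (mk∣ₛ coeff)
  where
  P = suc p
  oneMinusQ-coeff : ∀ t → oneMinusQ p t ≡ when (t ≡ᵇ 0) (+ 1) + when (t ≡ᵇ P) (- + 1)
  oneMinusQ-coeff = at (oneMinusQ≈binomialQ p)
  coeff : ∀ t → + P ZD.∣ pow (oneMinusQ 0) P t - oneMinusQ p t
  coeff t with N.<-cmp t P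
  coeff zero    | tri< _ _ _ rewrite coeff-pow-oneMinusQ P 0 = ZD.divides (+ 0) refl
  coeff (suc t) | tri< t<P _ _
    rewrite coeff-pow-oneMinusQ P (suc t) | oneMinusQ-coeff (suc t) | ≡ᵇ-false {suc t} {P} (NP.<⇒≢ t<P) =
    subst (+ P ZD.∣_) (sym (ZP.+-identityʳ (sign (suc t) * + (P C suc t))))
          (ZD.∣n⇒∣m*n (sign (suc t)) (+-pres-∣ (prime∣C P (suc t) p-prime (s≤s z≤n) t<P)))
  ... | tri≈ _ refl _
    rewrite coeff-pow-oneMinusQ P P | oneMinusQ-coeff P | nCn≡1 P | ≡ᵇ-true {P} {P} refl | sign-odd P p-odd =
    ZD.divides (+ 0) refl
  coeff (suc t) | tri> _ _ P<t
    rewrite coeff-pow-oneMinusQ P (suc t) | oneMinusQ-coeff (suc t) | ≡ᵇ-false {suc t} {P} (λ e → NP.<⇒≢ P<t (sym e))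
          | k>n⇒nCk≡0 P<t | ZP.*-zeroʳ (sign (suc t)) = ZD.divides (+ 0) refl

-- Infinite products

partialProduct : (ℕ → PS) → ℕ → PS
partialProduct P zero    = one
partialProduct P (suc N) = mul (P (suc N)) (partialProduct P N)

-- ∏_{j ≥ 1} P j read off coefficientwise; it is the genuine infinite product when P is Convergent,
-- i.e. when factor j is 1 + O(q^j).
product : (ℕ → PS) → PS
product P n = partialProduct P n n

OneBelow : ℕ → PS → Set
OneBelow j F = ∀ i → i < j → F i ≡ one i

Convergent : (ℕ → PS) → Set
Convergent P = ∀ j → OneBelow j (P j)

mul-OneBelow : ∀ j F G → OneBelow j F → ∀ n → n < j → mul F G n ≡ G n
mul-OneBelow j F G F≡1 n n<j =
  trans (sumTo-cong n (λ i i≤n → cong (_* G (n N.∸ i)) (F≡1 i (NP.≤-<-trans i≤n n<j)))) (at (mul-identityˡ G) n)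

OneBelow-mul : ∀ j F G → OneBelow j F → OneBelow j G → OneBelow j (mul F G)
OneBelow-mul j F G F≡1 G≡1 i i<j = trans (mul-OneBelow j F G F≡1 i i<j) (G≡1 i i<j)

OneBelow-pow : ∀ j F r → OneBelow j F → OneBelow j (pow F r)
OneBelow-pow j F zero    F≡1 i _ = refl
OneBelow-pow j F (suc r) F≡1 = OneBelow-mul j F (pow F r) F≡1 (OneBelow-pow j F r F≡1)

partialProduct-stable : ∀ P → Convergent P → ∀ N t i → i ≤ N → partialProduct P (N N.+ t) i ≡ partialProduct P N i
partialProduct-stable P conv N zero    i i≤N rewrite NP.+-identityʳ N = refl
partialProduct-stable P conv N (suc t) i i≤N rewrite NP.+-suc N t =
  trans (mul-OneBelow _ (P (suc (N N.+ t))) (partialProduct P (N N.+ t)) (conv _) i (s≤s (NP.≤-trans i≤N (NP.m≤m+n N t))))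
        (partialProduct-stable P conv N t i i≤N)

partialProduct-stable′ : ∀ P → Convergent P → ∀ N M i → i ≤ N → N ≤ M → partialProduct P M i ≡ partialProduct P N i
partialProduct-stable′ P conv N M i i≤N N≤M with NP.m≤n⇒∃[o]m+o≡n N≤M
... | t , refl = partialProduct-stable P conv N t i i≤N

product≡partialProduct : ∀ P → Convergent P → ∀ N i → i ≤ N → product P i ≡ partialProduct P N i
product≡partialProduct P conv N i i≤N = sym (partialProduct-stable′ P conv i N i NP.≤-refl i≤N)

partialProduct-cong : ∀ {P Q} → (∀ j → P (suc j) ≈ Q (suc j)) → ∀ N → partialProduct P N ≈ partialProduct Q N
partialProduct-cong P≈Q zero    = ≈-refl
partialProduct-cong P≈Q (suc N) = mul-cong (P≈Q N) (partialProduct-cong P≈Q N)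

product-cong : ∀ {P Q} → (∀ j → P (suc j) ≈ Q (suc j)) → product P ≈ product Q
product-cong P≈Q = mk≈ λ n → at (partialProduct-cong P≈Q n) n

partialProduct-≡[] : ∀ {m P Q} → (∀ j → P (suc j) ≡[ m ] Q (suc j)) → ∀ N → partialProduct P N ≡[ m ] partialProduct Q N
partialProduct-≡[] P≡Q zero    = ≡[]-refl
partialProduct-≡[] P≡Q (suc N) = ≡[]-mul (P≡Q N) (partialProduct-≡[] P≡Q N)

product-≡[] : ∀ {m P Q} → (∀ j → P (suc j) ≡[ m ] Q (suc j)) → product P ≡[ m ] product Q
product-≡[] P≡Q = mk≡[] (mk∣ₛ λ n → coeff-≡[] (partialProduct-≡[] P≡Q n) n)

partialProduct-mul : ∀ P Q N → partialProduct (λ j → mul (P j) (Q j)) N ≈ mul (partialProduct P N) (partialProduct Q N)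
partialProduct-mul P Q zero    = ≈-sym (mul-identityˡ one)
partialProduct-mul P Q (suc N) = ≈-trans (mul-cong (≈-refl {mul (P (suc N)) (Q (suc N))}) (partialProduct-mul P Q N))
  (solve 4 (λ a b c d → (a :* b) :* (c :* d) := (a :* c) :* (b :* d)) ≈-refl
           (P (suc N)) (Q (suc N)) (partialProduct P N) (partialProduct Q N))

product-mul : ∀ P Q → Convergent P → Convergent Q → product (λ j → mul (P j) (Q j)) ≈ mul (product P) (product Q)
product-mul P Q convP convQ = mk≈ λ n → trans (at (partialProduct-mul P Q n) n)
  (sumTo-cong n (λ i i≤n → sym (cong₂ _*_ (product≡partialProduct P convP n i i≤n)
                                          (product≡partialProduct Q convQ n (n N.∸ i) (NP.m∸n≤m n i)))))

product-one : product (λ _ → one) ≈ one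
product-one = mk≈ λ n → at (partialProduct-one n) n
  where
  partialProduct-one : ∀ N → partialProduct (λ _ → one) N ≈ one
  partialProduct-one zero    = ≈-refl
  partialProduct-one (suc N) = ≈-trans (mul-identityˡ _) (partialProduct-one N)

product-pow : ∀ P r → Convergent P → product (λ j → pow (P j) r) ≈ pow (product P) r
product-pow P zero    conv = product-one
product-pow P (suc r) conv =
  ≈-trans (product-mul P (λ j → pow (P j) r) conv (λ j → OneBelow-pow j (P j) r (conv j)))
          (mul-cong (≈-refl {product P}) (product-pow P r conv))

partialProduct-dilate : ∀ d P N → partialProduct (λ j → dilate (suc d) (P j)) N ≈ dilate (suc d) (partialProduct P N)
partialProduct-dilate d P zero    = ≈-sym (dilate-one d)
partialProduct-dilate d P (suc N) =
  ≈-trans (mul-cong (≈-refl {dilate (suc d) (P (suc N))}) (partialProduct-dilate d P N))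
          (≈-sym (dilate-mul d (P (suc N)) (partialProduct P N)))

product-dilate : ∀ d P → Convergent P → dilate (suc d) (product P) ≈ product (λ j → dilate (suc d) (P j))
product-dilate d P conv = mk≈ λ n → sym (trans (at (partialProduct-dilate d P n) n)
  (cong (when (n % suc d ≡ᵇ 0)) (sym (product≡partialProduct P conv n (n / suc d) (ND.m/n≤m n (suc d))))))

-- The factors (F j)(q^(d+1)) of the dilated product, moved to index (d+1)j so that they stay Convergent.
dilateFactors : ℕ → (ℕ → PS) → ℕ → PS
dilateFactors d F m = if m % suc d ≡ᵇ 0 then dilate (suc d) (F (m / suc d)) else one

dilateFactors-at : ∀ d F c r → r < suc d →
                   dilateFactors d F (c N.* suc d N.+ r) ≡ (if r ≡ᵇ 0 then dilate (suc d) (F c) else one)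
dilateFactors-at d F c r r<D rewrite [c*d+r]%d≡r d c r r<D | [c*d+r]/d≡c d c r r<D = refl

Convergent-dilateFactors : ∀ d F → Convergent F → Convergent (dilateFactors d F)
Convergent-dilateFactors d F conv = division-ind d (λ m → OneBelow m (dilateFactors d F m)) factor
  where
  dilate-OneBelow : ∀ c G → OneBelow c G → OneBelow (c N.* suc d) (dilate (suc d) G)
  dilate-OneBelow c G G≡1 i i<cD =
    trans (cong (when (i % suc d ≡ᵇ 0)) (G≡1 (i / suc d) (ND.m<n*o⇒m/o<n i<cD))) (at (dilate-one d) i)
  factor : ∀ c r → r < suc d → OneBelow (c N.* suc d N.+ r) (dilateFactors d F (c N.* suc d N.+ r))
  factor c r r<D rewrite dilateFactors-at d F c r r<D with r
  ... | zero  = subst (λ k → OneBelow k (dilate (suc d) (F c))) (sym (NP.+-identityʳ _)) (dilate-OneBelow c (F c) (conv c))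
  ... | suc _ = λ i _ → refl

partialProduct-dilateFactors : ∀ d F N → partialProduct (dilateFactors d F) (N N.* suc d) ≈ dilate (suc d) (partialProduct F N)
partialProduct-dilateFactors d F zero    = ≈-sym (dilate-one d)
partialProduct-dilateFactors d F (suc N) =
  ≈-trans (mul-cong top (≈-trans (skipGap d NP.≤-refl) (partialProduct-dilateFactors d F N)))
          (≈-sym (dilate-mul d (F (suc N)) (partialProduct F N)))
  where
  factor-at : ∀ c r → r < suc d → dilateFactors d F (c N.* suc d N.+ r) ≈ (if r ≡ᵇ 0 then dilate (suc d) (F c) else one)
  factor-at c r r<D = ≡⇒≈ (dilateFactors-at d F c r r<D)
  top : dilateFactors d F (suc (d N.+ N N.* suc d)) ≈ dilate (suc d) (F (suc N))
  top = ≈-trans (≡⇒≈ (cong (dilateFactors d F) (sym (NP.+-identityʳ (suc N N.* suc d))))) (factor-at (suc N) 0 (s≤s z≤n))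
  skipGap : ∀ k → k ≤ d →
            partialProduct (dilateFactors d F) (k N.+ N N.* suc d) ≈ partialProduct (dilateFactors d F) (N N.* suc d)
  skipGap zero    _   = ≈-refl
  skipGap (suc k) k<D = ≈-trans (mul-cong gap (skipGap k (NP.≤-trans (NP.n≤1+n k) k<D))) (mul-identityˡ _)
    where
    gap : dilateFactors d F (suc (k N.+ N N.* suc d)) ≈ one
    gap = ≈-trans (≡⇒≈ (cong (dilateFactors d F)
                    (trans (cong suc (NP.+-comm k (N N.* suc d))) (sym (NP.+-suc (N N.* suc d) k)))))
                  (factor-at N (suc k) (s≤s k<D))

product-dilateFactors : ∀ d F → Convergent F → product (dilateFactors d F) ≈ dilate (suc d) (product F)
product-dilateFactors d F conv = mk≈ λ n → begin
    partialProduct (dilateFactors d F) n n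
  ≡⟨ partialProduct-stable′ (dilateFactors d F) (Convergent-dilateFactors d F conv) n (n N.* suc d) n
                            NP.≤-refl (NP.m≤m*n n (suc d)) ⟨
    partialProduct (dilateFactors d F) (n N.* suc d) n
  ≡⟨ at (partialProduct-dilateFactors d F n) n ⟩
    dilate (suc d) (partialProduct F n) n
  ≡⟨ cong (when (n % suc d ≡ᵇ 0)) (product≡partialProduct F conv n (n / suc d) (ND.m/n≤m n (suc d))) ⟨
    dilate (suc d) (product F) n ∎
  where open ≡-Reasoning

-- The Euler product and its Frobenius congruence

eulerFactor : ℕ → PS
eulerFactor j = oneMinusQ (j N.∸ 1)

geomFactor : ℕ → PS
geomFactor j = geomQ (j N.∸ 1)

Convergent-eulerFactor : Convergent eulerFactor
Convergent-eulerFactor zero    i       ()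
Convergent-eulerFactor (suc j) zero    _         = refl
Convergent-eulerFactor (suc j) (suc i) (s≤s i<j) rewrite ≡ᵇ-false {i} {j} (NP.<⇒≢ i<j) = refl

Convergent-geomFactor : Convergent geomFactor
Convergent-geomFactor zero    i       ()
Convergent-geomFactor (suc j) zero    _   = refl
Convergent-geomFactor (suc j) (suc i) i<j rewrite ND.m<n⇒m%n≡m i<j = refl

prodPS≈partialProduct : ∀ (g : ℕ → PS) N → prodPS (map g (upTo N)) ≈ partialProduct (λ j → g (j N.∸ 1)) N
prodPS≈partialProduct g N rewrite LP.map-upTo g N = applyUpTo≈partialProduct g N
  where
  prodPS-applyUpTo : ∀ (g : ℕ → PS) N → prodPS (applyUpTo g (suc N)) ≈ mul (g N) (prodPS (applyUpTo g N))
  prodPS-applyUpTo g zero    = ≈-refl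
  prodPS-applyUpTo g (suc N) = ≈-trans (mul-cong (≈-refl {g 0}) (prodPS-applyUpTo (λ i → g (suc i)) N))
    (solve 3 (λ a b c → a :* (b :* c) := b :* (a :* c)) ≈-refl (g 0) (g (suc N)) (prodPS (applyUpTo (λ i → g (suc i)) N)))
  applyUpTo≈partialProduct : ∀ g N → prodPS (applyUpTo g N) ≈ partialProduct (λ j → g (j N.∸ 1)) N
  applyUpTo≈partialProduct g zero    = ≈-refl
  applyUpTo≈partialProduct g (suc N) =
    ≈-trans (prodPS-applyUpTo g N) (mul-cong (≈-refl {g N}) (applyUpTo≈partialProduct g N))

euler≈product : euler ≈ product eulerFactor
euler≈product = mk≈ λ n → at (prodPS≈partialProduct oneMinusQ n) n

eulerInv≈product : eulerInv ≈ product geomFactor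
eulerInv≈product = mk≈ λ n → at (prodPS≈partialProduct geomQ n) n

oneMinusQ-geomQ-inverse : ∀ j → mul (oneMinusQ j) (geomQ j) ≈ one
oneMinusQ-geomQ-inverse j = mk≈ λ n →
  trans (at (mul-cong (oneMinusQ≈binomialQ j) (≈-refl {geomQ j})) n) (trans (mul-binomialQ j (- + 1) (geomQ j) n) (coeff n))
  where
  coeff : ∀ n → geomQ j n + when (suc j ≤ᵇ n) (- + 1 * geomQ j (n N.∸ suc j)) ≡ one n
  coeff n with suc j NP.≤? n
  ... | no  n<j+1 rewrite ≤ᵇ-false n<j+1 =
    trans (ZP.+-identityʳ _) (Convergent-geomFactor (suc j) n (NP.≰⇒> n<j+1))
  ... | yes j+1≤n rewrite ≤ᵇ-true j+1≤n | ND.m≤n⇒[n∸m]%m≡n%m {suc j} j+1≤n = cancel n j+1≤n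
    where
    cancel : ∀ n → suc j ≤ n → geomQ j n + - + 1 * geomQ j n ≡ one n
    cancel (suc n) _ = trans (cong (_+_ (geomQ j (suc n))) (ZP.-1*i≡-i (geomQ j (suc n)))) (ZP.+-inverseʳ (geomQ j (suc n)))

euler-eulerInv-inverse : mul euler eulerInv ≈ one
euler-eulerInv-inverse =
  ≈-trans (mul-cong euler≈product eulerInv≈product)
  (≈-trans (≈-sym (product-mul eulerFactor geomFactor Convergent-eulerFactor Convergent-geomFactor))
  (≈-trans (product-cong oneMinusQ-geomQ-inverse) product-one))

frobenius-oneMinusQ-dilated : ∀ p → Prime (suc p) → suc p % 2 ≡ 1 → ∀ j →
                              pow (oneMinusQ j) (suc p) ≡[ + suc p ] dilate (suc p) (oneMinusQ j)
frobenius-oneMinusQ-dilated p p-prime p-odd j = begin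
    pow (oneMinusQ j) (suc p)
  ≈⟨ ≈⇒≡[] (pow-cong (suc p) (≈-sym (dilate-oneMinusQ j))) ⟩
    pow (dilate (suc j) (oneMinusQ 0)) (suc p)
  ≈⟨ ≈⇒≡[] (≈-sym (dilate-pow j (oneMinusQ 0) (suc p))) ⟩
    dilate (suc j) (pow (oneMinusQ 0) (suc p))
  ≈⟨ dilate-≡[] j (frobenius-oneMinusQ p p-prime p-odd) ⟩
    dilate (suc j) (oneMinusQ p)
  ≈⟨ ≈⇒≡[] (dilate-cong j (≈-sym (dilate-oneMinusQ p))) ⟩
    dilate (suc j) (dilate (suc p) (oneMinusQ 0))
  ≈⟨ ≈⇒≡[] (≈-trans (dilate-dilate-comm j p (oneMinusQ 0)) (dilate-cong p (dilate-oneMinusQ j))) ⟩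
    dilate (suc p) (oneMinusQ j) ∎
  where open ≡[]-Reasoning (+ suc p)

frobenius-euler : ∀ p → Prime (suc p) → suc p % 2 ≡ 1 → pow euler (suc p) ≡[ + suc p ] dilate (suc p) euler
frobenius-euler p p-prime p-odd = begin
    pow euler (suc p)
  ≈⟨ ≈⇒≡[] (≈-trans (pow-cong (suc p) euler≈product) (≈-sym (product-pow eulerFactor (suc p) Convergent-eulerFactor))) ⟩
    product (λ j → pow (eulerFactor j) (suc p))
  ≈⟨ product-≡[] (frobenius-oneMinusQ-dilated p p-prime p-odd) ⟩
    product (λ j → dilate (suc p) (eulerFactor j))
  ≈⟨ ≈⇒≡[] (≈-trans (≈-sym (product-dilate p eulerFactor Convergent-eulerFactor)) (dilate-cong p (≈-sym euler≈product))) ⟩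
    dilate (suc p) euler ∎
  where open ≡[]-Reasoning (+ suc p)

frobenius-euler-iterated : ∀ p → Prime (suc p) → suc p % 2 ≡ 1 → ∀ a m →
                           pow euler (suc p ^ (a N.+ m)) ≡[ + (suc p ^ m) ] dilate (suc p ^ a) (pow euler (suc p ^ m))
frobenius-euler-iterated p p-prime p-odd zero    m = ≈⇒≡[] (≈-sym (dilate-1 (pow euler (suc p ^ m))))
frobenius-euler-iterated p p-prime p-odd (suc a) m = begin
    pow euler (P N.* P ^ (a N.+ m))
  ≈⟨ ≈⇒≡[] (pow-* euler P (P ^ (a N.+ m))) ⟩
    pow (pow euler P) (P ^ (a N.+ m))
  ≈⟨ ≡[]-weaken P^m∣P^[1+a+m] (pow-^-lift P (pow euler P) (dilate P euler) (frobenius-euler p p-prime p-odd) (a N.+ m)) ⟩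
    pow (dilate P euler) (P ^ (a N.+ m))
  ≈⟨ ≈⇒≡[] (≈-sym (dilate-pow p euler (P ^ (a N.+ m)))) ⟩
    dilate P (pow euler (P ^ (a N.+ m)))
  ≈⟨ dilate-≡[] p (frobenius-euler-iterated p p-prime p-odd a m) ⟩
    dilate P (dilate (P ^ a) (pow euler (P ^ m)))
  ≈⟨ ≈⇒≡[] (dilate-dilate-nonzero p (P ^ a) (pow euler (P ^ m)) (NP.m^n>0 P a)) ⟩
    dilate (P ^ suc a) (pow euler (P ^ m)) ∎
  where
  open ≡[]-Reasoning (+ (suc p ^ m))
  P = suc p
  P^m∣P^[1+a+m] : + (P ^ m) ZD.∣ + (P ^ suc (a N.+ m))
  P^m∣P^[1+a+m] = +-pres-∣ (subst (P ^ m ∣_) (sym (NP.^-distribˡ-+-* P (suc a) m)) (NDiv.n∣m*n (P ^ suc a)))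

-- The generating function of pod_ℓ

parity : ∀ n → n % 2 ≡ 0 ⊎ n % 2 ≡ 1
parity n with n % 2 | ND.m%n<n n 2
... | zero        | _ = inj₁ refl
... | suc zero    | _ = inj₂ refl
... | suc (suc _) | s≤s (s≤s ())

%2-*-odd : ∀ m n → m % 2 ≡ 1 → (m N.* n) % 2 ≡ n % 2
%2-*-odd m n m-odd = begin
    (m N.* n) % 2
  ≡⟨ ND.%-distribˡ-* m n 2 ⟩
    ((m % 2) N.* (n % 2)) % 2
  ≡⟨ cong (λ r → (r N.* (n % 2)) % 2) m-odd ⟩
    (1 N.* (n % 2)) % 2
  ≡⟨ cong (_% 2) (NP.*-identityˡ (n % 2)) ⟩
    (n % 2) % 2
  ≡⟨ ND.m%n%n≡m%n n 2 ⟩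
    n % 2 ∎
  where open ≡-Reasoning

divisor-of-odd-is-odd : ∀ {p n} → p ∣ n → n % 2 ≡ 1 → p % 2 ≡ 1
divisor-of-odd-is-odd {p} {n} p∣n n-odd with parity p
... | inj₂ p-odd  = p-odd
... | inj₁ p-even = ⊥-elim (NP.0≢1+n (trans (sym (NDiv.n∣m⇒m%n≡0 n 2 (NDiv.∣-trans (NDiv.m%n≡0⇒n∣m p 2 p-even) p∣n))) n-odd))

-- podSeries ℓ = ∏_{ℓ ∤ m} φ m: a part m occurs at most once if m is odd, any number of times if m is even.
φ : ℕ → PS
φ j = if j % 2 ≡ᵇ 1 then binomialQ (j N.∸ 1) (+ 1) else geomQ (j N.∸ 1)

podFactor : ℕ → ℕ → PS
podFactor ℓ j = if does (ℓ ∣? j) then one else φ j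

podSeries : ℕ → PS
podSeries ℓ n = + pod ℓ n

+sum≡sumTo : ∀ n (h : ℕ → ℕ) → + sum (applyUpTo h (suc n)) ≡ sumTo n (λ j → + h j)
+sum≡sumTo zero    h = cong +_ (NP.+-identityʳ (h 0))
+sum≡sumTo (suc n) h = trans (ZP.pos-+ (h 0) _)
  (trans (cong (_+_ (+ h 0)) (+sum≡sumTo n (λ i → h (suc i)))) (sym (sumTo-shift n (λ j → + h j))))

mul-geomQ : ∀ m (G : PS) n → mul (geomQ m) G n ≡ sumTo n (λ c → when (c N.* suc m ≤ᵇ n) (G (n N.∸ c N.* suc m)))
mul-geomQ m G n = begin
    mul (geomQ m) G n
  ≡⟨ mul-as-double-sum (geomQ m) G n B n≤B ⟩
    sumTo B (λ i → sumTo B (λ j → when (i N.+ j ≡ᵇ n) (geomQ m i * G j)))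
  ≡⟨ sumTo-cong′ B (λ i → trans (sumTo-cong′ B (λ j → when-as-* (i N.+ j ≡ᵇ n) (geomQ m i) (G j))) (sumTo-*ˡ B (geomQ m i) _)) ⟩
    sumTo B (λ i → geomQ m i * sumTo B (λ j → G j * when (i N.+ j ≡ᵇ n) (+ 1)))
  ≡⟨ sumTo-dilate m (λ _ → + 1) (λ i → sumTo B (λ j → G j * when (i N.+ j ≡ᵇ n) (+ 1))) n ⟩
    sumTo n (λ c → + 1 * sumTo B (λ j → G j * when (c N.* suc m N.+ j ≡ᵇ n) (+ 1)))
  ≡⟨ sumTo-cong′ n (λ c → trans (ZP.*-identityˡ _)
       (trans (sumTo-cong′ B (λ j → *-when-1 (c N.* suc m N.+ j ≡ᵇ n) (G j))) (sumTo-when-+≡ᵇ n B (c N.* suc m) G n≤B))) ⟩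
    sumTo n (λ c → when (c N.* suc m ≤ᵇ n) (G (n N.∸ c N.* suc m))) ∎
  where
  open ≡-Reasoning
  B = n N.* suc m N.+ m
  n≤B : n ≤ B
  n≤B = NP.≤-trans (NP.m≤m*n n (suc m)) (NP.m≤m+n _ m)
  *-when-1 : ∀ b x → x * when b (+ 1) ≡ when b x
  *-when-1 true  x = ZP.*-identityʳ x
  *-when-1 false x = ZP.*-zeroʳ x

podCount≡partialProduct : ∀ ℓ m n → + podCount ℓ m n ≡ partialProduct (podFactor ℓ) m n
podCount≡partialProduct ℓ zero    zero    = refl
podCount≡partialProduct ℓ zero    (suc n) = refl
podCount≡partialProduct ℓ (suc m) n with does (ℓ ∣? suc m)
... | true = trans (podCount≡partialProduct ℓ m n) (sym (at (mul-identityˡ (partialProduct (podFactor ℓ) m)) n))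
... | false with suc m % 2 ≡ᵇ 1
...   | true = sym (begin
    mul (binomialQ m (+ 1)) Π n
  ≡⟨ mul-binomialQ m (+ 1) Π n ⟩
    Π n + when (suc m ≤ᵇ n) (+ 1 * Π (n N.∸ suc m))
  ≡⟨ cong₂ _+_ (sym (podCount≡partialProduct ℓ m n)) (oncePart (suc m ≤ᵇ n)) ⟩
    + podCount ℓ m n + + (if suc m ≤ᵇ n then podCount ℓ m (n N.∸ suc m) else 0)
  ≡⟨ ZP.pos-+ (podCount ℓ m n) _ ⟨
    + (podCount ℓ m n N.+ (if suc m ≤ᵇ n then podCount ℓ m (n N.∸ suc m) else 0)) ∎)
  where
  open ≡-Reasoning
  Π = partialProduct (podFactor ℓ) m
  oncePart : ∀ b → when b (+ 1 * Π (n N.∸ suc m)) ≡ + (if b then podCount ℓ m (n N.∸ suc m) else 0)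
  oncePart true  = trans (ZP.*-identityˡ _) (sym (podCount≡partialProduct ℓ m (n N.∸ suc m)))
  oncePart false = refl
...   | false = begin
    + sum (map (λ j → if j N.* suc m ≤ᵇ n then podCount ℓ m (n N.∸ j N.* suc m) else 0) (upTo (suc n)))
  ≡⟨ cong (λ js → + sum js) (LP.map-upTo _ (suc n)) ⟩
    + sum (applyUpTo (λ j → if j N.* suc m ≤ᵇ n then podCount ℓ m (n N.∸ j N.* suc m) else 0) (suc n))
  ≡⟨ +sum≡sumTo n _ ⟩
    sumTo n (λ c → + (if c N.* suc m ≤ᵇ n then podCount ℓ m (n N.∸ c N.* suc m) else 0))
  ≡⟨ sumTo-cong′ n (λ c → manyPart c (c N.* suc m ≤ᵇ n)) ⟩
    sumTo n (λ c → when (c N.* suc m ≤ᵇ n) (Π (n N.∸ c N.* suc m)))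
  ≡⟨ mul-geomQ m Π n ⟨
    mul (geomQ m) Π n ∎
  where
  open ≡-Reasoning
  Π = partialProduct (podFactor ℓ) m
  manyPart : ∀ c b → + (if b then podCount ℓ m (n N.∸ c N.* suc m) else 0) ≡ when b (Π (n N.∸ c N.* suc m))
  manyPart c true  = podCount≡partialProduct ℓ m (n N.∸ c N.* suc m)
  manyPart c false = refl

podSeries≈product : ∀ ℓ → podSeries ℓ ≈ product (podFactor ℓ)
podSeries≈product ℓ = mk≈ λ n → podCount≡partialProduct ℓ n n

φ-odd : ∀ j → j % 2 ≡ 1 → φ j ≡ binomialQ (j N.∸ 1) (+ 1)
φ-odd j j-odd rewrite j-odd = refl

φ-even : ∀ j → j % 2 ≡ 0 → φ j ≡ geomQ (j N.∸ 1)
φ-even j j-even rewrite j-even = refl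

dilate-φ : ∀ l → suc l % 2 ≡ 1 → ∀ k → dilate (suc l) (φ (suc k)) ≈ φ (suc l N.* suc k)
dilate-φ l l-odd k with parity (suc k)
... | inj₂ k-odd = begin
    dilate (suc l) (φ (suc k))
  ≈⟨ dilate-cong l (≡⇒≈ (φ-odd (suc k) k-odd)) ⟩
    dilate (suc l) (binomialQ k (+ 1))
  ≈⟨ dilate-cong l (≈-sym (dilate-binomialQ k (+ 1))) ⟩
    dilate (suc l) (dilate (suc k) (binomialQ 0 (+ 1)))
  ≈⟨ dilate-dilate l k (binomialQ 0 (+ 1)) ⟩
    dilate (suc l N.* suc k) (binomialQ 0 (+ 1))
  ≈⟨ dilate-binomialQ (k N.+ l N.* suc k) (+ 1) ⟩
    binomialQ (k N.+ l N.* suc k) (+ 1)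
  ≈⟨ ≡⇒≈ (φ-odd (suc l N.* suc k) (trans (%2-*-odd (suc l) (suc k) l-odd) k-odd)) ⟨
    φ (suc l N.* suc k) ∎
  where open ≈-Reasoning
... | inj₁ k-even = begin
    dilate (suc l) (φ (suc k))
  ≈⟨ dilate-cong l (≡⇒≈ (φ-even (suc k) k-even)) ⟩
    dilate (suc l) (dilate (suc k) (λ _ → + 1))
  ≈⟨ dilate-dilate l k (λ _ → + 1) ⟩
    dilate (suc l N.* suc k) (λ _ → + 1)
  ≈⟨ ≡⇒≈ (φ-even (suc l N.* suc k) (trans (%2-*-odd (suc l) (suc k) l-odd) k-even)) ⟨
    φ (suc l N.* suc k) ∎
  where open ≈-Reasoning

Convergent-φ : Convergent φ
Convergent-φ zero i ()
Convergent-φ (suc j) with parity (suc j)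
... | inj₁ j-even rewrite φ-even (suc j) j-even = Convergent-geomFactor (suc j)
... | inj₂ j-odd  rewrite φ-odd (suc j) j-odd  = binomialQ-OneBelow
  where
  binomialQ-OneBelow : OneBelow (suc j) (binomialQ j (+ 1))
  binomialQ-OneBelow zero    _         = refl
  binomialQ-OneBelow (suc i) (s≤s i<j) rewrite ≡ᵇ-false {i} {j} (NP.<⇒≢ i<j) = refl

Convergent-podFactor : ∀ ℓ → Convergent (podFactor ℓ)
Convergent-podFactor ℓ j with does (ℓ ∣? j)
... | true  = λ i _ → refl
... | false = Convergent-φ j

dilateFactors-divisible : ∀ d F m → suc d ∣ m → dilateFactors d F m ≡ dilate (suc d) (F (m / suc d))
dilateFactors-divisible d F m d∣m rewrite NDiv.n∣m⇒m%n≡0 m (suc d) d∣m = refl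

dilateFactors-indivisible : ∀ d F m → ¬ suc d ∣ m → dilateFactors d F m ≡ one
dilateFactors-indivisible d F m d∤m rewrite ≡ᵇ-false (λ m%d≡0 → d∤m (NDiv.m%n≡0⇒n∣m m (suc d) m%d≡0)) = refl

podFactor-divisible : ∀ ℓ j → ℓ ∣ j → podFactor ℓ j ≡ one
podFactor-divisible ℓ j ℓ∣j rewrite dec-true (ℓ ∣? j) ℓ∣j = refl

podFactor-indivisible : ∀ ℓ j → ¬ ℓ ∣ j → podFactor ℓ j ≡ φ j
podFactor-indivisible ℓ j ℓ∤j rewrite dec-false (ℓ ∣? j) ℓ∤j = refl

podFactor-mul-dilateFactors : ∀ l → suc l % 2 ≡ 1 → ∀ j →
                              mul (podFactor (suc l) (suc j)) (dilateFactors l φ (suc j)) ≈ φ (suc j)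
podFactor-mul-dilateFactors l l-odd j with suc l ∣? suc j
... | no ℓ∤j =
  ≈-trans (mul-cong (≡⇒≈ (podFactor-indivisible (suc l) (suc j) ℓ∤j)) (≡⇒≈ (dilateFactors-indivisible l φ (suc j) ℓ∤j)))
          (mul-identityʳ (φ (suc j)))
... | yes ℓ∣j =
  ≈-trans (mul-cong (≡⇒≈ (podFactor-divisible (suc l) (suc j) ℓ∣j)) (≡⇒≈ (dilateFactors-divisible l φ (suc j) ℓ∣j)))
  (≈-trans (mul-identityˡ _) (dilate-φ-quotient (suc j / suc l) (ND.m/n*n≡m ℓ∣j)))
  where
  dilate-φ-quotient : ∀ q → q N.* suc l ≡ suc j → dilate (suc l) (φ q) ≈ φ (suc j)
  dilate-φ-quotient zero    ()
  dilate-φ-quotient (suc k) kl≡j = ≈-trans (dilate-φ l l-odd k) (≡⇒≈ (cong φ (trans (NP.*-comm (suc l) (suc k)) kl≡j)))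

Φ : PS
Φ = product φ

podSeries-mul-dilate-Φ : ∀ l → suc l % 2 ≡ 1 → mul (podSeries (suc l)) (dilate (suc l) Φ) ≈ Φ
podSeries-mul-dilate-Φ l l-odd = begin
    mul (podSeries (suc l)) (dilate (suc l) Φ)
  ≈⟨ mul-cong (podSeries≈product (suc l)) (≈-sym (product-dilateFactors l φ Convergent-φ)) ⟩
    mul (product (podFactor (suc l))) (product (dilateFactors l φ))
  ≈⟨ product-mul (podFactor (suc l)) (dilateFactors l φ)
                 (Convergent-podFactor (suc l)) (Convergent-dilateFactors l φ Convergent-φ) ⟨
    product (λ j → mul (podFactor (suc l) j) (dilateFactors l φ j))
  ≈⟨ product-cong (podFactor-mul-dilateFactors l l-odd) ⟩
    Φ ∎
  where open ≈-Reasoning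

oddEulerFactor : ℕ → PS
oddEulerFactor j = if j % 2 ≡ᵇ 1 then eulerFactor j else one

oddEulerFactor-odd : ∀ j → j % 2 ≡ 1 → oddEulerFactor j ≡ eulerFactor j
oddEulerFactor-odd j j-odd rewrite j-odd = refl

oddEulerFactor-even : ∀ j → j % 2 ≡ 0 → oddEulerFactor j ≡ one
oddEulerFactor-even j j-even rewrite j-even = refl

Convergent-oddEulerFactor : Convergent oddEulerFactor
Convergent-oddEulerFactor j with parity j
... | inj₁ j-even rewrite oddEulerFactor-even j j-even = λ i _ → refl
... | inj₂ j-odd  rewrite oddEulerFactor-odd j j-odd   = Convergent-eulerFactor j

dilate-eulerFactor : ∀ a k → dilate (suc a) (eulerFactor (suc k)) ≈ eulerFactor (suc a N.* suc k)
dilate-eulerFactor a k = begin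
    dilate (suc a) (oneMinusQ k)
  ≈⟨ dilate-cong a (≈-sym (dilate-oneMinusQ k)) ⟩
    dilate (suc a) (dilate (suc k) (oneMinusQ 0))
  ≈⟨ dilate-dilate a k (oneMinusQ 0) ⟩
    dilate (suc a N.* suc k) (oneMinusQ 0)
  ≈⟨ dilate-oneMinusQ (k N.+ a N.* suc k) ⟩
    oneMinusQ (k N.+ a N.* suc k) ∎
  where open ≈-Reasoning

oddEulerFactor-mul-dilateFactors : ∀ j → mul (oddEulerFactor (suc j)) (dilateFactors 1 eulerFactor (suc j)) ≈ eulerFactor (suc j)
oddEulerFactor-mul-dilateFactors j with parity (suc j)
... | inj₂ j-odd =
  ≈-trans (mul-cong (≡⇒≈ (oddEulerFactor-odd (suc j) j-odd))
                    (≡⇒≈ (dilateFactors-indivisible 1 eulerFactor (suc j)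
                           (λ 2∣j → NP.0≢1+n (trans (sym (NDiv.n∣m⇒m%n≡0 _ 2 2∣j)) j-odd)))))
          (mul-identityʳ (eulerFactor (suc j)))
... | inj₁ j-even =
  ≈-trans (mul-cong (≡⇒≈ (oddEulerFactor-even (suc j) j-even)) (≡⇒≈ (dilateFactors-divisible 1 eulerFactor (suc j) 2∣j)))
          (≈-trans (mul-identityˡ _) (dilate-half (suc j / 2) (ND.m/n*n≡m 2∣j)))
  where
  2∣j : 2 ∣ suc j
  2∣j = NDiv.m%n≡0⇒n∣m (suc j) 2 j-even
  dilate-half : ∀ q → q N.* 2 ≡ suc j → dilate 2 (eulerFactor q) ≈ eulerFactor (suc j)
  dilate-half zero    ()
  dilate-half (suc k) k2≡j = ≈-trans (dilate-eulerFactor 1 k) (≡⇒≈ (cong eulerFactor (trans (NP.*-comm 2 (suc k)) k2≡j)))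

oddEuler-mul-dilate-euler : mul (product oddEulerFactor) (dilate 2 euler) ≈ euler
oddEuler-mul-dilate-euler = begin
    mul (product oddEulerFactor) (dilate 2 euler)
  ≈⟨ mul-cong (≈-refl {product oddEulerFactor})
              (≈-trans (dilate-cong 1 euler≈product) (≈-sym (product-dilateFactors 1 eulerFactor Convergent-eulerFactor))) ⟩
    mul (product oddEulerFactor) (product (dilateFactors 1 eulerFactor))
  ≈⟨ product-mul oddEulerFactor (dilateFactors 1 eulerFactor) Convergent-oddEulerFactor
                 (Convergent-dilateFactors 1 eulerFactor Convergent-eulerFactor) ⟨
    product (λ j → mul (oddEulerFactor j) (dilateFactors 1 eulerFactor j))
  ≈⟨ product-cong oddEulerFactor-mul-dilateFactors ⟩
    product eulerFactor
  ≈⟨ euler≈product ⟨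
    euler ∎
  where open ≈-Reasoning

onePlusQ-mul-oneMinusQ : mul (binomialQ 0 (+ 1)) (oneMinusQ 0) ≈ oneMinusQ 1
onePlusQ-mul-oneMinusQ = mk≈ λ n → trans (mul-binomialQ 0 (+ 1) (oneMinusQ 0) n) (coeff n)
  where
  coeff : ∀ n → oneMinusQ 0 n + when (1 ≤ᵇ n) (+ 1 * oneMinusQ 0 (n N.∸ 1)) ≡ oneMinusQ 1 n
  coeff zero                = refl
  coeff (suc zero)          = refl
  coeff (suc (suc zero))    = refl
  coeff (suc (suc (suc n))) = refl

φ-mul-eulerFactor : ∀ j → mul (φ (suc j)) (eulerFactor (suc j)) ≈ dilate 2 (oddEulerFactor (suc j))
φ-mul-eulerFactor j with parity (suc j)
... | inj₁ j-even rewrite φ-even (suc j) j-even | oddEulerFactor-even (suc j) j-even =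
  ≈-trans (mk≈ (mul-comm (geomQ j) (oneMinusQ j))) (≈-trans (oneMinusQ-geomQ-inverse j) (≈-sym (dilate-one 1)))
... | inj₂ j-odd  rewrite φ-odd (suc j) j-odd | oddEulerFactor-odd (suc j) j-odd = begin
    mul (binomialQ j (+ 1)) (oneMinusQ j)
  ≈⟨ mul-cong (≈-sym (dilate-binomialQ j (+ 1))) (≈-sym (dilate-oneMinusQ j)) ⟩
    mul (dilate (suc j) (binomialQ 0 (+ 1))) (dilate (suc j) (oneMinusQ 0))
  ≈⟨ dilate-mul j (binomialQ 0 (+ 1)) (oneMinusQ 0) ⟨
    dilate (suc j) (mul (binomialQ 0 (+ 1)) (oneMinusQ 0))
  ≈⟨ dilate-cong j (≈-trans onePlusQ-mul-oneMinusQ (≈-sym (dilate-oneMinusQ 1))) ⟩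
    dilate (suc j) (dilate 2 (oneMinusQ 0))
  ≈⟨ ≈-trans (dilate-dilate-comm j 1 (oneMinusQ 0)) (dilate-cong 1 (dilate-oneMinusQ j)) ⟩
    dilate 2 (oneMinusQ j) ∎
  where open ≈-Reasoning

Φ-mul-euler : mul Φ euler ≈ dilate 2 (product oddEulerFactor)
Φ-mul-euler = begin
    mul Φ euler
  ≈⟨ mul-cong (≈-refl {Φ}) euler≈product ⟩
    mul (product φ) (product eulerFactor)
  ≈⟨ product-mul φ eulerFactor Convergent-φ Convergent-eulerFactor ⟨
    product (λ j → mul (φ j) (eulerFactor j))
  ≈⟨ product-cong φ-mul-eulerFactor ⟩
    product (λ j → dilate 2 (oddEulerFactor j))
  ≈⟨ product-dilate 1 oddEulerFactor Convergent-oddEulerFactor ⟨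
    dilate 2 (product oddEulerFactor) ∎
  where open ≈-Reasoning

Φ-euler-identity : mul (mul Φ euler) (dilate 4 euler) ≈ dilate 2 euler
Φ-euler-identity = begin
    mul (mul Φ euler) (dilate 4 euler)
  ≈⟨ mul-cong Φ-mul-euler (≈-sym (dilate-dilate 1 1 euler)) ⟩
    mul (dilate 2 (product oddEulerFactor)) (dilate 2 (dilate 2 euler))
  ≈⟨ dilate-mul 1 (product oddEulerFactor) (dilate 2 euler) ⟨
    dilate 2 (mul (product oddEulerFactor) (dilate 2 euler))
  ≈⟨ dilate-cong 1 oddEuler-mul-dilate-euler ⟩
    dilate 2 euler ∎
  where open ≈-Reasoning

-- The eta quotient

f[_] : ℕ → PS
f[ d ] = dilate d euler

f⁻¹[_] : ℕ → PS
f⁻¹[ d ] = dilate d eulerInv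

f-f⁻¹ : ∀ D → 0 < D → mul f[ D ] f⁻¹[ D ] ≈ one
f-f⁻¹ (suc d) _ = ≈-trans (≈-sym (dilate-mul d euler eulerInv)) (≈-trans (dilate-cong d euler-eulerInv-inverse) (dilate-one d))

dilate-f : ∀ d D e → 0 < D → suc d N.* D ≡ e → dilate (suc d) f[ D ] ≈ f[ e ]
dilate-f d D e D>0 refl = dilate-dilate-nonzero d D euler D>0

dilate-mul₃ : ∀ d x y z → dilate (suc d) (mul x (mul y z)) ≈ mul (dilate (suc d) x) (mul (dilate (suc d) y) (dilate (suc d) z))
dilate-mul₃ d x y z = ≈-trans (dilate-mul d x (mul y z)) (mul-cong (≈-refl {dilate (suc d) x}) (dilate-mul d y z))

podSeries-eta-identity : ∀ l → suc l % 2 ≡ 1 →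
  mul (podSeries (suc l)) (mul euler (mul f[ 4 ] f[ suc l N.* 2 ])) ≈ mul f[ 2 ] (mul f[ suc l ] f[ suc l N.* 4 ])
podSeries-eta-identity l l-odd = begin
    mul X (mul euler (mul f[ 4 ] f[ ℓ N.* 2 ]))
  ≈⟨ mul-cong (≈-refl {X}) (mul-cong (≈-refl {euler}) (mul-cong (≈-refl {f[ 4 ]}) (≈-sym dilated-Φ-identity))) ⟩
    mul X (mul euler (mul f[ 4 ] (mul (mul Φₗ f[ ℓ ]) f[ ℓ N.* 4 ])))
  ≈⟨ solve 6 (λ X f f₄ Φₗ fₗ f₄ₗ → X :* (f :* (f₄ :* ((Φₗ :* fₗ) :* f₄ₗ))) := ((X :* Φₗ) :* f :* f₄) :* (fₗ :* f₄ₗ))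
             ≈-refl X euler f[ 4 ] Φₗ f[ ℓ ] f[ ℓ N.* 4 ] ⟩
    mul (mul (mul (mul X Φₗ) euler) f[ 4 ]) (mul f[ ℓ ] f[ ℓ N.* 4 ])
  ≈⟨ mul-cong (mul-cong (mul-cong (podSeries-mul-dilate-Φ l l-odd) (≈-refl {euler})) (≈-refl {f[ 4 ]}))
              (≈-refl {mul f[ ℓ ] f[ ℓ N.* 4 ]}) ⟩
    mul (mul (mul Φ euler) f[ 4 ]) (mul f[ ℓ ] f[ ℓ N.* 4 ])
  ≈⟨ mul-cong Φ-euler-identity (≈-refl {mul f[ ℓ ] f[ ℓ N.* 4 ]}) ⟩
    mul f[ 2 ] (mul f[ ℓ ] f[ ℓ N.* 4 ]) ∎
  where
  open ≈-Reasoning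
  ℓ = suc l
  X = podSeries ℓ
  Φₗ = dilate ℓ Φ
  dilated-Φ-identity : mul (mul Φₗ f[ ℓ ]) f[ ℓ N.* 4 ] ≈ f[ ℓ N.* 2 ]
  dilated-Φ-identity = begin
      mul (mul Φₗ f[ ℓ ]) f[ ℓ N.* 4 ]
    ≈⟨ mul-cong (≈-sym (dilate-mul l Φ euler)) (≈-sym (dilate-dilate l 3 euler)) ⟩
      mul (dilate ℓ (mul Φ euler)) (dilate ℓ f[ 4 ])
    ≈⟨ dilate-mul l (mul Φ euler) f[ 4 ] ⟨
      dilate ℓ (mul (mul Φ euler) f[ 4 ])
    ≈⟨ dilate-cong l Φ-euler-identity ⟩
      dilate ℓ f[ 2 ]
    ≈⟨ dilate-dilate l 1 euler ⟩
      f[ ℓ N.* 2 ] ∎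

podSeries-eta-identity-24 : ∀ l → suc l % 2 ≡ 1 →
  mul (dilate 24 (podSeries (suc l))) (mul f[ 24 ] (mul f[ 96 ] f[ 48 N.* suc l ]))
    ≈ mul f[ 48 ] (mul f[ 24 N.* suc l ] f[ 96 N.* suc l ])
podSeries-eta-identity-24 l l-odd = begin
    mul (dilate 24 X) (mul f[ 24 ] (mul f[ 96 ] f[ 48 N.* ℓ ]))
  ≈⟨ mul-cong (≈-refl {dilate 24 X}) (mul-cong (≈-refl {f[ 24 ]})
       (mul-cong (≈-sym (dilate-f 23 4 96 (s≤s z≤n) refl)) (≈-sym (dilate-f 23 (ℓ N.* 2) (48 N.* ℓ) (s≤s z≤n) (24ℓ2≡48ℓ l))))) ⟩
    mul (dilate 24 X) (mul (dilate 24 euler) (mul (dilate 24 f[ 4 ]) (dilate 24 f[ ℓ N.* 2 ])))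
  ≈⟨ ≈-trans (dilate-mul 23 X (mul euler (mul f[ 4 ] f[ ℓ N.* 2 ])))
             (mul-cong (≈-refl {dilate 24 X}) (dilate-mul₃ 23 euler f[ 4 ] f[ ℓ N.* 2 ])) ⟨
    dilate 24 (mul X (mul euler (mul f[ 4 ] f[ ℓ N.* 2 ])))
  ≈⟨ dilate-cong 23 (podSeries-eta-identity l l-odd) ⟩
    dilate 24 (mul f[ 2 ] (mul f[ ℓ ] f[ ℓ N.* 4 ]))
  ≈⟨ dilate-mul₃ 23 f[ 2 ] f[ ℓ ] f[ ℓ N.* 4 ] ⟩
    mul (dilate 24 f[ 2 ]) (mul (dilate 24 f[ ℓ ]) (dilate 24 f[ ℓ N.* 4 ]))
  ≈⟨ mul-cong (dilate-f 23 2 48 (s≤s z≤n) refl)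
              (mul-cong (dilate-f 23 ℓ (24 N.* ℓ) (s≤s z≤n) refl) (dilate-f 23 (ℓ N.* 4) (96 N.* ℓ) (s≤s z≤n) (24ℓ4≡96ℓ l))) ⟩
    mul f[ 48 ] (mul f[ 24 N.* ℓ ] f[ 96 N.* ℓ ]) ∎
  where
  open ≈-Reasoning
  open import Data.Nat.Tactic.RingSolver using (solve-∀)
  ℓ = suc l
  X = podSeries ℓ
  24ℓ2≡48ℓ : ∀ l → 24 N.* (suc l N.* 2) ≡ 48 N.* suc l
  24ℓ2≡48ℓ = solve-∀
  24ℓ4≡96ℓ : ∀ l → 24 N.* (suc l N.* 4) ≡ 96 N.* suc l
  24ℓ4≡96ℓ = solve-∀

-- η(48z) η(24ℓz) η(96ℓz) / (η(96z) η(48ℓz)) without its power of q.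
podEtaQuotient : ℕ → PS
podEtaQuotient ℓ = mul f[ 48 ] (mul f[ 24 N.* ℓ ] (mul f[ 96 N.* ℓ ] (mul f⁻¹[ 96 ] f⁻¹[ 48 N.* ℓ ])))

podSeries-eta-quotient : ∀ l → suc l % 2 ≡ 1 → mul (dilate 24 (podSeries (suc l))) f[ 24 ] ≈ podEtaQuotient (suc l)
podSeries-eta-quotient l l-odd = begin
    mul Y f[ 24 ]
  ≈⟨ mul-identityʳ (mul Y f[ 24 ]) ⟨
    mul (mul Y f[ 24 ]) one
  ≈⟨ mul-cong (≈-refl {mul Y f[ 24 ]})
              (≈-sym (≈-trans (mul-cong (f-f⁻¹ 96 (s≤s z≤n)) (f-f⁻¹ (48 N.* ℓ) (s≤s z≤n))) (mul-identityˡ one))) ⟩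
    mul (mul Y f[ 24 ]) (mul (mul f[ 96 ] f⁻¹[ 96 ]) (mul f[ 48 N.* ℓ ] f⁻¹[ 48 N.* ℓ ]))
  ≈⟨ solve 6 (λ Y a b c b′ c′ → (Y :* a) :* ((b :* b′) :* (c :* c′)) := (Y :* (a :* (b :* c))) :* (b′ :* c′))
             ≈-refl Y f[ 24 ] f[ 96 ] f[ 48 N.* ℓ ] f⁻¹[ 96 ] f⁻¹[ 48 N.* ℓ ] ⟩
    mul (mul Y (mul f[ 24 ] (mul f[ 96 ] f[ 48 N.* ℓ ]))) (mul f⁻¹[ 96 ] f⁻¹[ 48 N.* ℓ ])
  ≈⟨ mul-cong (podSeries-eta-identity-24 l l-odd) (≈-refl {mul f⁻¹[ 96 ] f⁻¹[ 48 N.* ℓ ]}) ⟩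
    mul (mul f[ 48 ] (mul f[ 24 N.* ℓ ] f[ 96 N.* ℓ ])) (mul f⁻¹[ 96 ] f⁻¹[ 48 N.* ℓ ])
  ≈⟨ solve 5 (λ d e h b′ c′ → (d :* (e :* h)) :* (b′ :* c′) := d :* (e :* (h :* (b′ :* c′))))
             ≈-refl f[ 48 ] f[ 24 N.* ℓ ] f[ 96 N.* ℓ ] f⁻¹[ 96 ] f⁻¹[ 48 N.* ℓ ] ⟩
    podEtaQuotient ℓ ∎
  where
  open ≈-Reasoning
  ℓ = suc l
  Y = dilate 24 (podSeries ℓ)

etaProd-theQuotient : ∀ ℓ P a k → 0 < P →
  mul (etaProd (theQuotient ℓ P a k)) f[ 24 ]
    ≈ mul (mul (pow f[ 24 ] (P ^ (a N.+ k))) (pow f⁻¹[ 24 N.* P ^ a ] (P ^ k))) (podEtaQuotient ℓ)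
etaProd-theQuotient ℓ P a k P>0 = begin
    mul (etaProd (theQuotient ℓ P a k)) f[ 24 ]
  ≈⟨ mul-cong factors (≈-refl {f[ 24 ]}) ⟩
    mul unfolded f[ 24 ]
  ≈⟨ solve 8 (λ u a b c d e g W → (u :* (a :* (b :* (c :* (d :* (e :* W)))))) :* g
                                  := ((g :* u) :* W) :* (a :* (b :* (c :* (d :* e)))))
             ≈-refl (pow f[ 24 ] (x N.∸ 1)) f[ 48 ] f[ 24 N.* ℓ ] f[ 96 N.* ℓ ] f⁻¹[ 96 ] f⁻¹[ 48 N.* ℓ ] f[ 24 ] W ⟩
    mul (mul (mul f[ 24 ] (pow f[ 24 ] (x N.∸ 1))) W) (podEtaQuotient ℓ)
  ≈⟨ mul-cong (mul-cong (pow-pred x x>0) (≈-refl {W})) (≈-refl {podEtaQuotient ℓ}) ⟩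
    mul (mul (pow f[ 24 ] x) W) (podEtaQuotient ℓ) ∎
  where
  open ≈-Reasoning
  x = P ^ (a N.+ k)
  x>0 : 0 < x
  x>0 = NP.m^n>0 P ⦃ N.>-nonZero P>0 ⦄ (a N.+ k)
  W = pow f⁻¹[ 24 N.* P ^ a ] (P ^ k)
  pow-pred : ∀ x → 0 < x → mul f[ 24 ] (pow f[ 24 ] (x N.∸ 1)) ≈ pow f[ 24 ] x
  pow-pred (suc x) _ = ≈-refl
  etaFactor-pred : ∀ d x → 0 < x → etaFactor (d , + x - + 1) ≈ pow f[ d ] (x N.∸ 1)
  etaFactor-pred d (suc x) _ = ≈-refl
  etaFactor-neg : ∀ d y → etaFactor (d , - + y) ≈ pow f⁻¹[ d ] y
  etaFactor-neg d zero    = ≈-refl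
  etaFactor-neg d (suc y) = ≈-refl
  unfolded = mul (pow f[ 24 ] (x N.∸ 1)) (mul f[ 48 ] (mul f[ 24 N.* ℓ ] (mul f[ 96 N.* ℓ ] (mul f⁻¹[ 96 ] (mul f⁻¹[ 48 N.* ℓ ] W)))))
  factors : etaProd (theQuotient ℓ P a k) ≈ unfolded
  factors =
    mul-cong (etaFactor-pred 24 x x>0) (
    mul-cong (mul-identityʳ f[ 48 ]) (
    mul-cong (mul-identityʳ f[ 24 N.* ℓ ]) (
    mul-cong (mul-identityʳ f[ 96 N.* ℓ ]) (
    mul-cong (mul-identityʳ f⁻¹[ 96 ]) (
    mul-cong (mul-identityʳ f⁻¹[ 48 N.* ℓ ]) (
    ≈-trans (mul-identityʳ _) (etaFactor-neg (24 N.* P ^ a) (P ^ k))))))))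

frobenius-cancellation : ∀ p → Prime (suc p) → suc p % 2 ≡ 1 → ∀ a k →
  mul (pow f[ 24 ] (suc p ^ (a N.+ k))) (pow f⁻¹[ 24 N.* suc p ^ a ] (suc p ^ k)) ≡[ + (suc p ^ k) ] one
frobenius-cancellation p p-prime p-odd a k = begin
    mul (pow f[ 24 ] (P ^ (a N.+ k))) (pow f⁻¹[ A ] (P ^ k))
  ≈⟨ ≡[]-mulʳ (pow f⁻¹[ A ] (P ^ k)) (≈⇒≡[] (≈-sym (dilate-pow 23 euler (P ^ (a N.+ k))))) ⟩
    mul (dilate 24 (pow euler (P ^ (a N.+ k)))) (pow f⁻¹[ A ] (P ^ k))
  ≈⟨ ≡[]-mulʳ (pow f⁻¹[ A ] (P ^ k)) (dilate-≡[] 23 (frobenius-euler-iterated p p-prime p-odd a k)) ⟩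
    mul (dilate 24 (dilate (P ^ a) (pow euler (P ^ k)))) (pow f⁻¹[ A ] (P ^ k))
  ≈⟨ ≈⇒≡[] (mul-cong (≈-trans (dilate-dilate-nonzero 23 (P ^ a) (pow euler (P ^ k)) (NP.m^n>0 P a))
                               (dilate-pow-nonzero A euler (P ^ k) A>0))
                     (≈-refl {pow f⁻¹[ A ] (P ^ k)})) ⟩
    mul (pow f[ A ] (P ^ k)) (pow f⁻¹[ A ] (P ^ k))
  ≈⟨ ≈⇒≡[] (≈-trans (≈-sym (pow-mul f[ A ] f⁻¹[ A ] (P ^ k))) (≈-trans (pow-cong (P ^ k) (f-f⁻¹ A A>0)) (pow-one (P ^ k)))) ⟩
    one ∎
  where
  open ≡[]-Reasoning (+ (suc p ^ k))
  P = suc p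
  A = 24 N.* P ^ a
  A>0 : 0 < A
  A>0 = NP.<-≤-trans (NP.m^n>0 P a) (NP.m≤n*m (P ^ a) 24)

theQuotient-≡[]-podSeries : ∀ l p a k → suc l % 2 ≡ 1 → Prime (suc p) → suc p % 2 ≡ 1 →
  etaProd (theQuotient (suc l) (suc p) a k) ≡[ + (suc p ^ k) ] dilate 24 (podSeries (suc l))
theQuotient-≡[]-podSeries l p a k ℓ-odd p-prime p-odd =
  ≡[]-cancelʳ {u = f[ 24 ]} {v = f⁻¹[ 24 ]} (f-f⁻¹ 24 (s≤s z≤n)) (begin
    mul (etaProd (theQuotient ℓ P a k)) f[ 24 ]
  ≈⟨ ≈⇒≡[] (etaProd-theQuotient ℓ P a k (s≤s z≤n)) ⟩
    mul (mul (pow f[ 24 ] (P ^ (a N.+ k))) (pow f⁻¹[ 24 N.* P ^ a ] (P ^ k))) (podEtaQuotient ℓ)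
  ≈⟨ ≡[]-mulʳ (podEtaQuotient ℓ) (frobenius-cancellation p p-prime p-odd a k) ⟩
    mul one (podEtaQuotient ℓ)
  ≈⟨ ≈⇒≡[] (≈-trans (mul-identityˡ (podEtaQuotient ℓ)) (≈-sym (podSeries-eta-quotient l ℓ-odd))) ⟩
    mul (dilate 24 (podSeries ℓ)) f[ 24 ] ∎)
  where
  open ≡[]-Reasoning (+ (suc p ^ k))
  ℓ = suc l
  P = suc p

-- Comparing coefficients

coeffℤ : PS → ℤ → ℤ
coeffℤ f (+ n)    = f n
coeffℤ f -[1+ _ ] = + 0

≡[]-coeffℤ : ∀ {M f g} → f ≡[ M ] g → ∀ z → M ZD.∣ coeffℤ f z - coeffℤ g z
≡[]-coeffℤ f≡g (+ n)    = coeff-≡[] f≡g n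
≡[]-coeffℤ f≡g -[1+ _ ] = ZD.divides (+ 0) refl

coeffℤ-dilate : ∀ d f z → coeffℤ (dilate (suc d) f) (+ suc d * z) ≡ coeffℤ f z
coeffℤ-dilate d f (+ n) rewrite sym (ZP.pos-* (suc d) n) =
  trans (cong (dilate (suc d) f) (trans (NP.*-comm (suc d) n) (sym (NP.+-identityʳ _)))) (dilate-at d f n 0 (s≤s z≤n))
coeffℤ-dilate d f -[1+ n ] = refl

etaCoeff≡coeffℤ : ∀ Q c e → order24 Q ≡ + 24 * + c → etaCoeff Q e ≡ coeffℤ (etaProd Q) (e - + c)
etaCoeff≡coeffℤ Q c e order≡ = begin
    etaCoeff Q e
  ≡⟨ unfold ⟩
    coeffℤ (dilate 24 (etaProd Q)) (+ 24 * e - order24 Q)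
  ≡⟨ cong (λ o → coeffℤ (dilate 24 (etaProd Q)) (+ 24 * e - o)) order≡ ⟩
    coeffℤ (dilate 24 (etaProd Q)) (+ 24 * e - + 24 * + c)
  ≡⟨ cong (coeffℤ (dilate 24 (etaProd Q))) (factor e (+ c)) ⟩
    coeffℤ (dilate 24 (etaProd Q)) (+ 24 * (e - + c))
  ≡⟨ coeffℤ-dilate 23 (etaProd Q) (e - + c) ⟩
    coeffℤ (etaProd Q) (e - + c) ∎
  where
  open ≡-Reasoning
  factor : ∀ e c → + 24 * e - + 24 * c ≡ + 24 * (e - c)
  factor = solve-∀
    where open import Data.Integer.Tactic.RingSolver using (solve-∀)
  unfold : etaCoeff Q e ≡ coeffℤ (dilate 24 (etaProd Q)) (+ 24 * e - order24 Q)
  unfold with + 24 * e - order24 Q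
  ... | + m      = refl
  ... | -[1+ _ ] = refl

podSeriesCoeff≡coeffℤ : ∀ ℓ e → podSeriesCoeff ℓ e ≡ coeffℤ (dilate 24 (podSeries ℓ)) (e - + (3 N.* (ℓ N.∸ 1)))
podSeriesCoeff≡coeffℤ ℓ e with e - + (3 N.* (ℓ N.∸ 1))
... | + m      = refl
... | -[1+ _ ] = refl

eta-pod-coefficients : ∀ ℓ Q {M} → order24 Q ≡ + 24 * + (3 N.* (ℓ N.∸ 1)) → etaProd Q ≡[ M ] dilate 24 (podSeries ℓ) →
                       ∀ e → M ZD.∣ etaCoeff Q e - podSeriesCoeff ℓ e
eta-pod-coefficients ℓ Q {M} order≡ Q≡pod e =
  subst (M ZD.∣_) (sym (cong₂ _-_ (etaCoeff≡coeffℤ Q (3 N.* (ℓ N.∸ 1)) e order≡) (podSeriesCoeff≡coeffℤ ℓ e)))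
        (≡[]-coeffℤ Q≡pod (e - + (3 N.* (ℓ N.∸ 1))))

theQuotient-order24-identity : ∀ A K L →
  + 24 * (A * K - + 1) + (+ 48 * + 1 + (+ 24 * L * + 1 + (+ 96 * L * + 1
    + (+ 96 * - + 1 + (+ 48 * L * - + 1 + (+ 24 * A * - K + + 0)))))) ≡ + 24 * (+ 3 * (L - + 1))
theQuotient-order24-identity = solve-∀
  where open import Data.Integer.Tactic.RingSolver using (solve-∀)

theQuotient-order24 : ∀ l P a k → order24 (theQuotient (suc l) P a k) ≡ + 24 * + (3 N.* l)
theQuotient-order24 l P a k = begin
    order24 (theQuotient (suc l) P a k)
  ≡⟨⟩
    shape (+ (P ^ (a N.+ k))) (+ (24 N.* suc l)) (+ (96 N.* suc l)) (+ (48 N.* suc l)) (+ (24 N.* P ^ a)) (+ (P ^ k))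
  ≡⟨ shape-cong (trans (cong +_ (NP.^-distribˡ-+-* P a k)) (ZP.pos-* (P ^ a) (P ^ k)))
                (ZP.pos-* 24 (suc l)) (ZP.pos-* 96 (suc l)) (ZP.pos-* 48 (suc l)) (ZP.pos-* 24 (P ^ a)) ⟩
    shape (+ (P ^ a) * + (P ^ k)) (+ 24 * + suc l) (+ 96 * + suc l) (+ 48 * + suc l) (+ 24 * + (P ^ a)) (+ (P ^ k))
  ≡⟨ theQuotient-order24-identity (+ (P ^ a)) (+ (P ^ k)) (+ suc l) ⟩
    + 24 * (+ 3 * + l)
  ≡⟨ cong (+ 24 *_) (ZP.pos-* 3 l) ⟨
    + 24 * + (3 N.* l) ∎
  where
  open ≡-Reasoning
  -- order24 unfolded by hand: rewriting would normalise 24 * suc l into unary arithmetic.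
  shape : ℤ → ℤ → ℤ → ℤ → ℤ → ℤ → ℤ
  shape x y z w v u = + 24 * (x - + 1) + (+ 48 * + 1 + (y * + 1 + (z * + 1 + (+ 96 * - + 1 + (w * - + 1 + (v * - u + + 0))))))
  shape-cong : ∀ {x x′ y y′ z z′ w w′ v v′ u} → x ≡ x′ → y ≡ y′ → z ≡ z′ → w ≡ w′ → v ≡ v′ →
               shape x y z w v u ≡ shape x′ y′ z′ w′ v′ u
  shape-cong refl refl refl refl refl = refl

lemma1 : (ℓ p a k : ℕ) → ℓ % 2 ≡ 1 → 1 < ℓ → Prime p → p ∣ ℓ
    → 1 ≤ a → p ^ a ∣ ℓ → ¬ (p ^ suc a ∣ ℓ) → 1 ≤ k
    → (e : ℤ) → (+ (p ^ k)) ℤd.∣ (etaCoeff (theQuotient ℓ p a k) e - podSeriesCoeff ℓ e)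
lemma1 zero    p       a k _     ()  _       _   _ _ _ _ e
lemma1 (suc l) zero    a k _     _   _       0∣ℓ _ _ _ _ e = ⊥-elim (NP.0≢1+n (sym (NDiv.0∣⇒≡0 0∣ℓ)))
lemma1 (suc l) (suc p) a k ℓ-odd _   p-prime p∣ℓ _ _ _ _ e =
  ZD.∣⇒∣ᵤ (eta-pod-coefficients (suc l) (theQuotient (suc l) (suc p) a k)
             (theQuotient-order24 l (suc p) a k)
             (theQuotient-≡[]-podSeries l p a k ℓ-odd p-prime (divisor-of-odd-is-odd p∣ℓ ℓ-odd))
             e)
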